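{- For every even integer $n\geq 2$, the polynomial $C_n(x)$ has no real roots. For every odd integer $n\geq 3$, the polynomial $C_n(x)$ has exactly one real root, and it lies in the open interval $(-1,0)$.
   Context: The polynomials $B_n\in\mathbb{Q}[s]$ are defined by $B_1=0$ and, for $n\geq 1$, $B_{n+1}$ is the unique polynomial with $B_{n+1}(1)=0$ and $B_{n+1}'(s)=B_n(s)-\frac{s^{n-1}}{n!}$. For $n\geq 2$, the polynomial $C_n$ is defined by $B_n(s)=-\frac{1}{(n-1)!}(s-1)C_n(s-1)$; explicitly $C_n(x)=\sum_{k=0}^{n-2}\binom{n-1}{k+1}(H_{n-1}-H_{n-k-2})x^k$, where $H_m=1+\frac12+\cdots+\frac1m$ and $H_0=0$. -}

module Defs where

open import Level using (0ℓ)
open import Data.Nat as ℕ using (ℕ; zero; suc; _∸_)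
open import Data.Nat.Combinatorics using (_C_)
open import Data.Integer as ℤ using (ℤ; +_; -[1+_])
open import Data.Rational as ℚ using (ℚ; mkℚ)
open import Data.List using (List; []; _∷_; map; upTo)
open import Data.Product using (Σ; ∃; _×_)
open import Relation.Nullary using (¬_)
open import Data.Sum using (_⊎_)
open import Relation.Binary.PropositionalEquality using (_≡_)

import Algebra.Structures as AS
import Relation.Binary.Structures as RS

-- The real numbers, axiomatised as a complete ordered field
-- (any model of these axioms is isomorphic to ℝ).

record RealField : Set₁ where
  infixl 7 _*_
  infixl 6 _+_
  infix  4 _<_ _≤_
  field
    Carrier : Set
    _+_ _*_ : Carrier → Carrier → Carrier
    -_      : Carrier → Carrier
    _⁻¹     : Carrier → Carrier
    0# 1#   : Carrier
    _<_     : Carrier → Carrier → Set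
    isCommutativeRing : AS.IsCommutativeRing {A = Carrier} _≡_ _+_ _*_ -_ 0# 1#
    0≢1       : ¬ (0# ≡ 1#)
    ⁻¹-inverse : ∀ x → ¬ (x ≡ 0#) → x * (x ⁻¹) ≡ 1#
    isStrictTotalOrder : RS.IsStrictTotalOrder {A = Carrier} _≡_ _<_
    +-mono-<  : ∀ {x y} z → x < y → x + z < y + z
    *-pos     : ∀ {x y} → 0# < x → 0# < y → 0# < x * y

  _≤_ : Carrier → Carrier → Set
  x ≤ y = (x < y) ⊎ (x ≡ y)

  IsUpperBound : (Carrier → Set) → Carrier → Set
  IsUpperBound P b = ∀ x → P x → x ≤ b

  field
    lub : (P : Carrier → Set) → ∃ P → ∃ (IsUpperBound P) →
          Σ Carrier λ s → IsUpperBound P s × (∀ b → IsUpperBound P b → s ≤ b)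

  fromℕ : ℕ → Carrier
  fromℕ zero    = 0#
  fromℕ (suc n) = 1# + fromℕ n

  fromℤ : ℤ → Carrier
  fromℤ (+ n)     = fromℕ n
  fromℤ -[1+ n ]  = - (fromℕ (suc n))

  fromℚ : ℚ → Carrier
  fromℚ q = fromℤ (ℚ.numerator q) * (fromℕ (suc (ℚ.denominator-1 q)) ⁻¹)

  eval : List ℚ → Carrier → Carrier
  eval []       x = 0#
  eval (a ∷ as) x = fromℚ a + x * eval as x


H : ℕ → ℚ
H zero    = ℚ.0ℚ
H (suc m) = H m ℚ.+ (+ 1 ℚ./ suc m)

-- C_n(x) = Σ_{k=0}^{n-2} binom(n-1,k+1) (H_{n-1} - H_{n-k-2}) x^k,
-- represented by its coefficient list [c₀, …, c_{n-2}] (for n ≥ 2).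

Ccoeff : ℕ → ℕ → ℚ
Ccoeff n k = (+ ((n ∸ 1) C (suc k)) ℚ./ 1) ℚ.* (H (n ∸ 1) ℚ.- H (n ∸ (k ℕ.+ 2)))

C : ℕ → List ℚ
C n = map (Ccoeff n) (upTo (n ∸ 1))

-- Write S_d = C_{d+2} and r = x/(1+x). Pascal's rule for the coefficients gives the
-- recurrence S_{d+1}(x) = (1+x) S_d(x) + x^{d+1}/(d+2), which turns into
-- x S_d(x) = (1+x)^{d+1} L_{d+1}(r), where L_N(r) = Σ_{j=1}^N r^j/j is a partial sum of
-- -log(1-r). Since S_d(0) = 1 and S_d(-1) = (-1)^d/(d+1), a real root x of S_d yields a
-- root r ≠ 0 of L_{d+1}; as L_N > 0 on (0, ∞) we get r < 0, i.e. -1 < x < 0.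
-- Group L_N into pairs r^{m+1}/(m+1) + r^{m+2}/(m+2). On [-1, 0) each pair with m even is
-- negative; on (-∞, -1] the pairs are strictly monotone, since with s = -r the difference
-- quotient of s^{m+2}/(m+2) - s^{m+1}/(m+1) is (m+1) h_{m+1} - (m+2) h_m (up to a positive
-- factor) for the complete homogeneous polynomials h_m, and this equals
-- (s - 1) ∂ₛh_{m+1} + (t - 1) ∂ₜh_{m+1} by Euler's identity. Hence L_{2k+1} < 0 on (-∞, 0),
-- so C_n has no root for n even, while L_{2k+2} is negative on [-1, 0) and strictly
-- decreasing on (-∞, -1], so C_n has at most one root for n odd. It has one because
-- C_n(-1) < 0 < C_n(0) and polynomials, being Lipschitz on [-1, 1], have the intermediate
-- value property by completeness.

module Submission where

open import Defs
open import Data.Nat as N using (ℕ; _%_)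
open import Data.Product using (Σ; _×_)
open import Relation.Nullary using (¬_)
open import Relation.Binary.PropositionalEquality using (_≡_)

module Binomial where

  open import Data.Nat
  open import Data.Nat.Properties
  open import Data.Nat.DivMod using (/-congʳ; n/n≡1)
  open import Data.Nat.Combinatorics
    using (nC1≡n; k>n⇒nCk≡0; nCk≡n!/k![n-k]!; nCk+nC[k+1]≡[n+1]C[k+1]) renaming (_C_ to _choose_)
  open import Relation.Binary.PropositionalEquality
  open ≡-Reasoning

  nC0≡1 : ∀ n → n choose 0 ≡ 1
  nC0≡1 n = begin
    n choose 0       ≡⟨ nCk≡n!/k![n-k]! {n} {0} z≤n ⟩
    n ! / (1 * n !)  ≡⟨ /-congʳ (*-identityˡ (n !)) ⟩
    n ! / n !        ≡⟨ n/n≡1 (n !) ⟩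
    1                ∎
    where instance
      _ = n !≢0
      _ = 0 !* n !≢0

  [k+1]*[n+1]C[k+1]≡[n+1]*nCk : ∀ n k → suc k * (suc n choose suc k) ≡ suc n * (n choose k)
  [k+1]*[n+1]C[k+1]≡[n+1]*nCk zero (suc k) = begin
    suc (suc k) * (1 choose suc (suc k))  ≡⟨ cong (suc (suc k) *_) (k>n⇒nCk≡0 {1} {suc (suc k)} (s<s z<s)) ⟩
    suc (suc k) * 0                       ≡⟨ *-zeroʳ (suc (suc k)) ⟩
    0                                     ≡⟨ cong (1 *_) (k>n⇒nCk≡0 {0} {suc k} z<s) ⟨
    1 * (0 choose suc k)                  ∎
  [k+1]*[n+1]C[k+1]≡[n+1]*nCk n zero = begin
    1 * (suc n choose 1)  ≡⟨ *-identityˡ _ ⟩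
    suc n choose 1        ≡⟨ nC1≡n (suc n) ⟩
    suc n                 ≡⟨ *-identityʳ (suc n) ⟨
    suc n * 1             ≡⟨ cong (suc n *_) (nC0≡1 n) ⟨
    suc n * (n choose 0)  ∎
  [k+1]*[n+1]C[k+1]≡[n+1]*nCk (suc n) (suc k) = begin
    suc (suc k) * (suc (suc n) choose suc (suc k))
      ≡⟨ cong (suc (suc k) *_) (nCk+nC[k+1]≡[n+1]C[k+1] (suc n) (suc k)) ⟨
    suc (suc k) * (a + b)
      ≡⟨ *-distribˡ-+ (suc (suc k)) a b ⟩
    (a + suc k * a) + suc (suc k) * b
      ≡⟨ cong₂ (λ u v → (a + u) + v) ([k+1]*[n+1]C[k+1]≡[n+1]*nCk n k) ([k+1]*[n+1]C[k+1]≡[n+1]*nCk n (suc k)) ⟩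
    (a + suc n * (n choose k)) + suc n * (n choose suc k)
      ≡⟨ +-assoc a _ _ ⟩
    a + (suc n * (n choose k) + suc n * (n choose suc k))
      ≡⟨ cong (a +_) (*-distribˡ-+ (suc n) (n choose k) (n choose suc k)) ⟨
    a + suc n * (n choose k + n choose suc k)
      ≡⟨ cong (λ u → a + suc n * u) (nCk+nC[k+1]≡[n+1]C[k+1] n k) ⟩
    suc (suc n) * a ∎
    where
    a b : ℕ
    a = suc n choose suc k
    b = suc n choose suc (suc k)

  [k+1]*nC[k+1]≡[n-k]*nCk : ∀ k e → suc k * ((k + e) choose suc k) ≡ e * ((k + e) choose k)
  [k+1]*nC[k+1]≡[n-k]*nCk k e = +-cancelˡ-≡ (suc k * (n choose k)) _ _ (begin
    suc k * (n choose k) + suc k * (n choose suc k)  ≡⟨ *-distribˡ-+ (suc k) (n choose k) _ ⟨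
    suc k * (n choose k + n choose suc k)            ≡⟨ cong (suc k *_) (nCk+nC[k+1]≡[n+1]C[k+1] n k) ⟩
    suc k * (suc n choose suc k)                     ≡⟨ [k+1]*[n+1]C[k+1]≡[n+1]*nCk n k ⟩
    (suc k + e) * (n choose k)                       ≡⟨ *-distribʳ-+ (n choose k) (suc k) e ⟩
    suc k * (n choose k) + e * (n choose k)          ∎)
    where
    n : ℕ
    n = k + e

  [n+1-k]*[n+1]Ck≡[n+1]*nCk : ∀ k a → suc a * (suc (k + a) choose k) ≡ suc (k + a) * ((k + a) choose k)
  [n+1-k]*[n+1]Ck≡[n+1]*nCk k a = begin
    suc a * (suc (k + a) choose k)      ≡⟨ cong (λ m → suc a * (m choose k)) (+-suc k a) ⟨
    suc a * ((k + suc a) choose k)      ≡⟨ [k+1]*nC[k+1]≡[n-k]*nCk k (suc a) ⟨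
    suc k * ((k + suc a) choose suc k)  ≡⟨ cong (λ m → suc k * (m choose suc k)) (+-suc k a) ⟩
    suc k * (suc (k + a) choose suc k)  ≡⟨ [k+1]*[n+1]C[k+1]≡[n+1]*nCk (k + a) k ⟩
    suc (k + a) * ((k + a) choose k)    ∎

module Parity where

  open import Data.Nat
  open import Data.Nat.DivMod using (m≡m%n+[m/n]*n)
  open import Data.Product using (∃; _,_)
  open import Relation.Binary.PropositionalEquality

  even-≥2 : ∀ n → 2 ≤ n → n % 2 ≡ 0 → ∃ λ k → n ≡ suc (suc (k * 2))
  even-≥2 n 2≤n n%2≡0 = from-quotient (n / 2) (trans (m≡m%n+[m/n]*n n 2) (cong (_+ (n / 2) * 2) n%2≡0))
    where
    from-quotient : ∀ q → n ≡ q * 2 → ∃ λ k → n ≡ suc (suc (k * 2))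
    from-quotient zero    n≡0 with () ← subst (2 ≤_) n≡0 2≤n
    from-quotient (suc k) n≡2+2k = k , n≡2+2k

  odd-≥3 : ∀ n → 3 ≤ n → n % 2 ≡ 1 → ∃ λ k → n ≡ suc (suc (suc (k * 2)))
  odd-≥3 n 3≤n n%2≡1 = from-quotient (n / 2) (trans (m≡m%n+[m/n]*n n 2) (cong (_+ (n / 2) * 2) n%2≡1))
    where
    from-quotient : ∀ q → n ≡ suc (q * 2) → ∃ λ k → n ≡ suc (suc (suc (k * 2)))
    from-quotient zero    n≡1 with s≤s () ← subst (3 ≤_) n≡1 3≤n
    from-quotient (suc k) n≡3+2k = k , n≡3+2k

module OrderedFieldProperties (R : RealField) where

  open import Level using (0ℓ)
  open import Algebra.Bundles using (CommutativeRing)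
  import Algebra.Solver.Ring.AlmostCommutativeRing as ACR
  open import Data.Nat as ℕ using (ℕ; zero; suc)
  import Data.Nat.Properties as ℕ
  open import Data.Integer as ℤ using (ℤ; -[1+_]; _⊖_)
  import Data.Integer.Properties as ℤ
  open import Data.Empty using (⊥-elim)
  open import Data.Maybe using (Maybe; just; nothing)
  open import Data.Sum using (_⊎_; inj₁; inj₂)
  open import Relation.Binary.Bundles using (StrictTotalOrder)
  open import Relation.Binary.Definitions using (Tri; tri<; tri≈; tri>)
  open import Relation.Binary.PropositionalEquality
  open import Relation.Nullary using (¬_; yes; no)

  open RealField R public

  commutativeRing : CommutativeRing 0ℓ 0ℓ
  commutativeRing = record { isCommutativeRing = isCommutativeRing }

  open CommutativeRing commutativeRing public
    using (+-assoc; +-comm; +-identityˡ; +-identityʳ; -‿inverseʳ;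
           *-assoc; *-comm; *-identityˡ; *-identityʳ; distribʳ; zeroˡ; zeroʳ; ring)
  open import Algebra.Properties.Ring ring public
    using (-0#≈0#; -‿involutive; -‿+-comm; -1*x≈-x; -‿distribˡ-*; -‿distribʳ-*)

  infixl 6 _-_
  _-_ : Carrier → Carrier → Carrier
  x - y = x + - y

  fromℕ-+ : ∀ m n → fromℕ (m ℕ.+ n) ≡ fromℕ m + fromℕ n
  fromℕ-+ zero    n = sym (+-identityˡ _)
  fromℕ-+ (suc m) n = trans (cong (1# +_) (fromℕ-+ m n)) (sym (+-assoc _ _ _))

  fromℕ-* : ∀ m n → fromℕ (m ℕ.* n) ≡ fromℕ m * fromℕ n
  fromℕ-* zero    n = sym (zeroˡ _)
  fromℕ-* (suc m) n = begin
    fromℕ (n ℕ.+ m ℕ.* n)             ≡⟨ fromℕ-+ n (m ℕ.* n) ⟩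
    fromℕ n + fromℕ (m ℕ.* n)         ≡⟨ cong₂ _+_ (sym (*-identityˡ _)) (fromℕ-* m n) ⟩
    1# * fromℕ n + fromℕ m * fromℕ n  ≡⟨ distribʳ _ _ _ ⟨
    (1# + fromℕ m) * fromℕ n          ∎
    where open ≡-Reasoning

  fromℤ-⊖ : ∀ m n → fromℤ (m ⊖ n) ≡ fromℕ m - fromℕ n
  fromℤ-⊖ m       zero    = sym (trans (cong (fromℕ m +_) -0#≈0#) (+-identityʳ _))
  fromℤ-⊖ zero    (suc n) = sym (+-identityˡ _)
  fromℤ-⊖ (suc m) (suc n) = begin
    fromℤ (suc m ⊖ suc n)              ≡⟨ cong fromℤ (ℤ.[1+m]⊖[1+n]≡m⊖n m n) ⟩
    fromℤ (m ⊖ n)                      ≡⟨ fromℤ-⊖ m n ⟩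
    fromℕ m - fromℕ n                  ≡⟨ +-identityˡ _ ⟨
    0# + (fromℕ m - fromℕ n)           ≡⟨ cong (_+ (fromℕ m - fromℕ n)) (-‿inverseʳ 1#) ⟨
    (1# - 1#) + (fromℕ m - fromℕ n)    ≡⟨ interchange 1# (- 1#) (fromℕ m) (- fromℕ n) ⟩
    (1# + fromℕ m) + (- 1# - fromℕ n)  ≡⟨ cong ((1# + fromℕ m) +_) (-‿+-comm 1# (fromℕ n)) ⟩
    (1# + fromℕ m) - (1# + fromℕ n)    ∎
    where
    open ≡-Reasoning
    open import Algebra.Properties.CommutativeSemigroup
      (CommutativeRing.+-commutativeSemigroup commutativeRing) using (interchange)

  fromℤ-+ : ∀ i j → fromℤ (i ℤ.+ j) ≡ fromℤ i + fromℤ j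
  fromℤ-+ (ℤ.+ m)    (ℤ.+ n)    = fromℕ-+ m n
  fromℤ-+ (ℤ.+ m)    -[1+ n ] = fromℤ-⊖ m (suc n)
  fromℤ-+ -[1+ m ] (ℤ.+ n)    = trans (fromℤ-⊖ n (suc m)) (+-comm _ _)
  fromℤ-+ -[1+ m ] -[1+ n ] = begin
    - fromℕ (suc (suc (m ℕ.+ n)))      ≡⟨ cong (λ k → - fromℕ k) (ℕ.+-suc (suc m) n) ⟨
    - fromℕ (suc m ℕ.+ suc n)          ≡⟨ cong -_ (fromℕ-+ (suc m) (suc n)) ⟩
    - (fromℕ (suc m) + fromℕ (suc n))  ≡⟨ -‿+-comm _ _ ⟨
    - fromℕ (suc m) - fromℕ (suc n)    ∎
    where open ≡-Reasoning

  fromℤ-neg : ∀ i → fromℤ (ℤ.- i) ≡ - fromℤ i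
  fromℤ-neg (ℤ.+ zero)  = sym -0#≈0#
  fromℤ-neg (ℤ.+ suc n) = refl
  fromℤ-neg -[1+ n ]  = sym (-‿involutive _)

  fromℤ-*-+ : ∀ i n → fromℤ (i ℤ.* ℤ.+ n) ≡ fromℤ i * fromℕ n
  fromℤ-*-+ (ℤ.+ m)    n = trans (cong fromℤ (sym (ℤ.pos-* m n))) (fromℕ-* m n)
  fromℤ-*-+ -[1+ m ] n = begin
    fromℤ (ℤ.- (ℤ.+ suc m) ℤ.* ℤ.+ n)  ≡⟨ cong fromℤ (ℤ.neg-distribˡ-* (ℤ.+ suc m) (ℤ.+ n)) ⟨
    fromℤ (ℤ.- (ℤ.+ suc m ℤ.* ℤ.+ n))  ≡⟨ fromℤ-neg (ℤ.+ suc m ℤ.* ℤ.+ n) ⟩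
    - fromℤ (ℤ.+ suc m ℤ.* ℤ.+ n)      ≡⟨ cong -_ (fromℤ-*-+ (ℤ.+ suc m) n) ⟩
    - (fromℕ (suc m) * fromℕ n)        ≡⟨ -‿distribˡ-* _ _ ⟩
    - fromℕ (suc m) * fromℕ n          ∎
    where open ≡-Reasoning

  fromℤ-* : ∀ i j → fromℤ (i ℤ.* j) ≡ fromℤ i * fromℤ j
  fromℤ-* i (ℤ.+ n)    = fromℤ-*-+ i n
  fromℤ-* i -[1+ n ] = begin
    fromℤ (i ℤ.* ℤ.- (ℤ.+ suc n))  ≡⟨ cong fromℤ (ℤ.neg-distribʳ-* i (ℤ.+ suc n)) ⟨
    fromℤ (ℤ.- (i ℤ.* ℤ.+ suc n))  ≡⟨ fromℤ-neg (i ℤ.* ℤ.+ suc n) ⟩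
    - fromℤ (i ℤ.* ℤ.+ suc n)      ≡⟨ cong -_ (fromℤ-*-+ i (suc n)) ⟩
    - (fromℤ i * fromℕ (suc n))    ≡⟨ -‿distribʳ-* _ _ ⟩
    fromℤ i * - fromℕ (suc n)      ∎
    where open ≡-Reasoning

  -- Copies of fromℕ and fromℤ sending 1 to 1# itself rather than to 1# + 0#, so
  -- that the constants of the solver below evaluate to the literals in goals.
  fromℕ′ : ℕ → Carrier
  fromℕ′ zero          = 0#
  fromℕ′ (suc zero)    = 1#
  fromℕ′ (suc (suc n)) = 1# + fromℕ′ (suc n)

  fromℤ′ : ℤ → Carrier
  fromℤ′ (ℤ.+ n)    = fromℕ′ n
  fromℤ′ -[1+ n ]   = - fromℕ′ (suc n)

  fromℕ′≡fromℕ : ∀ n → fromℕ′ n ≡ fromℕ n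
  fromℕ′≡fromℕ zero          = refl
  fromℕ′≡fromℕ (suc zero)    = sym (+-identityʳ 1#)
  fromℕ′≡fromℕ (suc (suc n)) = cong (1# +_) (fromℕ′≡fromℕ (suc n))

  fromℤ′≡fromℤ : ∀ i → fromℤ′ i ≡ fromℤ i
  fromℤ′≡fromℤ (ℤ.+ n)  = fromℕ′≡fromℕ n
  fromℤ′≡fromℤ -[1+ n ] = cong -_ (fromℕ′≡fromℕ (suc n))

  private
    almostCommutativeRing : ACR.AlmostCommutativeRing 0ℓ 0ℓ
    almostCommutativeRing = ACR.fromCommutativeRing commutativeRing

    ℤ⟶Carrier : CommutativeRing.rawRing ℤ.+-*-commutativeRing ACR.-Raw-AlmostCommutative⟶ almostCommutativeRing
    ℤ⟶Carrier = record
      { ⟦_⟧    = fromℤ′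
      ; +-homo = λ i j → homo (i ℤ.+ j) (fromℤ-+ i j) (cong₂ _+_ (fromℤ′≡fromℤ i) (fromℤ′≡fromℤ j))
      ; *-homo = λ i j → homo (i ℤ.* j) (fromℤ-* i j) (cong₂ _*_ (fromℤ′≡fromℤ i) (fromℤ′≡fromℤ j))
      ; -‿homo = λ i → homo (ℤ.- i) (fromℤ-neg i) (cong -_ (fromℤ′≡fromℤ i))
      ; 0-homo = refl
      ; 1-homo = refl
      }
      where
      homo : ∀ i {y z} → fromℤ i ≡ y → z ≡ y → fromℤ′ i ≡ z
      homo i p q = trans (fromℤ′≡fromℤ i) (trans p (sym q))

    fromℤ′-≟ : ∀ i j → Maybe (fromℤ′ i ≡ fromℤ′ j)
    fromℤ′-≟ i j with i ℤ.≟ j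
    ... | yes refl = just refl
    ... | no _     = nothing

  open import Algebra.Solver.Ring (CommutativeRing.rawRing ℤ.+-*-commutativeRing)
    almostCommutativeRing ℤ⟶Carrier fromℤ′-≟ public
    using (Polynomial; solve; _:=_; _:+_; _:*_; :-_; _:-_; con)

  :0 :1 : ∀ {n} → Polynomial n
  :0 = con (ℤ.+ 0)
  :1 = con (ℤ.+ 1)

  strictTotalOrder : StrictTotalOrder 0ℓ 0ℓ 0ℓ
  strictTotalOrder = record { isStrictTotalOrder = isStrictTotalOrder }

  open StrictTotalOrder strictTotalOrder public
    using (compare; strictPartialOrder) renaming (trans to <-trans; asym to <-asym)
  open import Relation.Binary.Properties.StrictTotalOrder strictTotalOrder public
    using () renaming (refl to ≤-refl; trans to ≤-trans; antisym to ≤-antisym)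

  <-irrefl : ∀ {x} → ¬ (x < x)
  <-irrefl = StrictTotalOrder.irrefl strictTotalOrder refl

  <⇒≢ : ∀ {x y} → x < y → ¬ (x ≡ y)
  <⇒≢ x<y refl = <-irrefl x<y

  >⇒≢ : ∀ {x y} → y < x → ¬ (x ≡ y)
  >⇒≢ y<x refl = <-irrefl y<x

  <-≤-trans : ∀ {x y z} → x < y → y ≤ z → x < z
  <-≤-trans x<y (inj₁ y<z) = <-trans x<y y<z
  <-≤-trans x<y (inj₂ refl) = x<y

  ≤-<-trans : ∀ {x y z} → x ≤ y → y < z → x < z
  ≤-<-trans (inj₁ x<y) y<z = <-trans x<y y<z
  ≤-<-trans (inj₂ refl) y<z = y<z

  <⇒≱ : ∀ {x y} → x < y → ¬ (y ≤ x)
  <⇒≱ x<y y≤x = <-irrefl (<-≤-trans x<y y≤x)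

  ≤-<-cases : ∀ x y → x ≤ y ⊎ y < x
  ≤-<-cases x y with compare x y
  ... | tri< x<y _ _ = inj₁ (inj₁ x<y)
  ... | tri≈ _ x≡y _ = inj₁ (inj₂ x≡y)
  ... | tri> _ _ y<x = inj₂ y<x

  +-monoʳ-< : ∀ {x y} z → x < y → x + z < y + z
  +-monoʳ-< = +-mono-<

  +-monoˡ-< : ∀ {x y} z → x < y → z + x < z + y
  +-monoˡ-< {x} {y} z x<y = subst₂ _<_ (+-comm x z) (+-comm y z) (+-mono-< z x<y)

  +-monoʳ-≤ : ∀ {x y} z → x ≤ y → x + z ≤ y + z
  +-monoʳ-≤ z (inj₁ x<y) = inj₁ (+-monoʳ-< z x<y)
  +-monoʳ-≤ z (inj₂ refl) = ≤-refl

  +-monoˡ-≤ : ∀ {x y} z → x ≤ y → z + x ≤ z + y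
  +-monoˡ-≤ z (inj₁ x<y) = inj₁ (+-monoˡ-< z x<y)
  +-monoˡ-≤ z (inj₂ refl) = ≤-refl

  +-mono-≤ : ∀ {a b c d} → a ≤ b → c ≤ d → a + c ≤ b + d
  +-mono-≤ {b = b} {c} a≤b c≤d = ≤-trans (+-monoʳ-≤ c a≤b) (+-monoˡ-≤ b c≤d)

  +-mono-<-≤ : ∀ {a b c d} → a < b → c ≤ d → a + c < b + d
  +-mono-<-≤ {b = b} {c} a<b c≤d = <-≤-trans (+-monoʳ-< c a<b) (+-monoˡ-≤ b c≤d)

  +-mono-≤-< : ∀ {a b c d} → a ≤ b → c < d → a + c < b + d
  +-mono-≤-< {b = b} {c} a≤b c<d = ≤-<-trans (+-monoʳ-≤ c a≤b) (+-monoˡ-< b c<d)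

  x+[y-x]≡y : ∀ x y → x + (y - x) ≡ y
  x+[y-x]≡y = solve 2 (λ x y → x :+ (y :- x) := y) refl

  x<y⇒0<y-x : ∀ {x y} → x < y → 0# < y - x
  x<y⇒0<y-x {x} x<y = subst (_< _) (-‿inverseʳ x) (+-monoʳ-< (- x) x<y)

  0<y-x⇒x<y : ∀ {x y} → 0# < y - x → x < y
  0<y-x⇒x<y {x} {y} 0<y-x = subst₂ _<_ (+-identityʳ x) (x+[y-x]≡y x y) (+-monoˡ-< x 0<y-x)

  x≤y⇒0≤y-x : ∀ {x y} → x ≤ y → 0# ≤ y - x
  x≤y⇒0≤y-x (inj₁ x<y) = inj₁ (x<y⇒0<y-x x<y)
  x≤y⇒0≤y-x {x} (inj₂ refl) = inj₂ (sym (-‿inverseʳ x))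

  neg-antimono-< : ∀ {x y} → x < y → - y < - x
  neg-antimono-< {x} {y} x<y = subst₂ _<_ (lhs x y) (rhs x y) (+-monoʳ-< (- x - y) x<y)
    where
    lhs : ∀ x y → x + (- x - y) ≡ - y
    lhs = solve 2 (λ x y → x :+ (:- x :- y) := :- y) refl
    rhs : ∀ x y → y + (- x - y) ≡ - x
    rhs = solve 2 (λ x y → y :+ (:- x :- y) := :- x) refl

  neg-antimono-≤ : ∀ {x y} → x ≤ y → - y ≤ - x
  neg-antimono-≤ (inj₁ x<y) = inj₁ (neg-antimono-< x<y)
  neg-antimono-≤ (inj₂ refl) = ≤-refl

  0<x⇒-x<0 : ∀ {x} → 0# < x → - x < 0#
  0<x⇒-x<0 0<x = subst (_ <_) -0#≈0# (neg-antimono-< 0<x)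

  x<0⇒0<-x : ∀ {x} → x < 0# → 0# < - x
  x<0⇒0<-x x<0 = subst (_< _) -0#≈0# (neg-antimono-< x<0)

  0≤x⇒-x≤0 : ∀ {x} → 0# ≤ x → - x ≤ 0#
  0≤x⇒-x≤0 0≤x = subst (_ ≤_) -0#≈0# (neg-antimono-≤ 0≤x)

  +-pos-nonneg : ∀ {x y} → 0# < x → 0# ≤ y → 0# < x + y
  +-pos-nonneg 0<x 0≤y = subst (_< _) (+-identityʳ 0#) (+-mono-<-≤ 0<x 0≤y)

  +-nonneg-pos : ∀ {x y} → 0# ≤ x → 0# < y → 0# < x + y
  +-nonneg-pos 0≤x 0<y = subst (_< _) (+-identityʳ 0#) (+-mono-≤-< 0≤x 0<y)

  +-nonneg-nonneg : ∀ {x y} → 0# ≤ x → 0# ≤ y → 0# ≤ x + y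
  +-nonneg-nonneg 0≤x 0≤y = subst (_≤ _) (+-identityʳ 0#) (+-mono-≤ 0≤x 0≤y)

  +-nonpos-neg : ∀ {x y} → x ≤ 0# → y < 0# → x + y < 0#
  +-nonpos-neg x≤0 y<0 = subst (_ <_) (+-identityʳ 0#) (+-mono-≤-< x≤0 y<0)

  0<1 : 0# < 1#
  0<1 with compare 0# 1#
  ... | tri< 0<1 _ _ = 0<1
  ... | tri≈ _ 0≡1 _ = ⊥-elim (0≢1 0≡1)
  ... | tri> _ _ 1<0 = ⊥-elim (<-asym 1<0 (subst (0# <_) -1*-1≡1 (*-pos 0<-1 0<-1)))
    where
    0<-1 : 0# < - 1#
    0<-1 = x<0⇒0<-x 1<0
    -1*-1≡1 : - 1# * - 1# ≡ 1#
    -1*-1≡1 = solve 0 (:- :1 :* :- :1 := :1) refl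

  *-monoˡ-< : ∀ {x y z} → 0# < z → x < y → z * x < z * y
  *-monoˡ-< {x} {y} {z} 0<z x<y = 0<y-x⇒x<y (subst (0# <_) (z[y-x]≡zy-zx z x y) (*-pos 0<z (x<y⇒0<y-x x<y)))
    where
    z[y-x]≡zy-zx : ∀ z x y → z * (y - x) ≡ z * y - z * x
    z[y-x]≡zy-zx = solve 3 (λ z x y → z :* (y :- x) := z :* y :- z :* x) refl

  *-monoʳ-< : ∀ {x y z} → 0# < z → x < y → x * z < y * z
  *-monoʳ-< {x} {y} {z} 0<z x<y = subst₂ _<_ (*-comm z x) (*-comm z y) (*-monoˡ-< 0<z x<y)

  *-monoˡ-≤ : ∀ {x y z} → 0# ≤ z → x ≤ y → z * x ≤ z * y
  *-monoˡ-≤ (inj₁ 0<z) (inj₁ x<y) = inj₁ (*-monoˡ-< 0<z x<y)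
  *-monoˡ-≤ (inj₂ refl) _ = inj₂ (trans (zeroˡ _) (sym (zeroˡ _)))
  *-monoˡ-≤ _ (inj₂ refl) = ≤-refl

  *-monoʳ-≤ : ∀ {x y z} → 0# ≤ z → x ≤ y → x * z ≤ y * z
  *-monoʳ-≤ {x} {y} {z} 0≤z x≤y = subst₂ _≤_ (*-comm z x) (*-comm z y) (*-monoˡ-≤ 0≤z x≤y)

  *-nonneg : ∀ {x y} → 0# ≤ x → 0# ≤ y → 0# ≤ x * y
  *-nonneg {x} 0≤x 0≤y = subst (_≤ _) (zeroʳ x) (*-monoˡ-≤ 0≤x 0≤y)

  *-nonneg-nonpos : ∀ {x y} → 0# ≤ x → y ≤ 0# → x * y ≤ 0#
  *-nonneg-nonpos {x} 0≤x y≤0 = subst (_ ≤_) (zeroʳ x) (*-monoˡ-≤ 0≤x y≤0)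

  *-pos-neg : ∀ {x y} → 0# < x → y < 0# → x * y < 0#
  *-pos-neg {x} 0<x y<0 = subst (_ <_) (zeroʳ x) (*-monoˡ-< 0<x y<0)

  *-neg-pos : ∀ {x y} → x < 0# → 0# < y → x * y < 0#
  *-neg-pos {x} {y} x<0 0<y = subst (_< 0#) (*-comm y x) (*-pos-neg 0<y x<0)

  *-neg-neg : ∀ {x y} → x < 0# → y < 0# → 0# < x * y
  *-neg-neg {x} {y} x<0 y<0 = subst (0# <_) (-x*-y≡x*y x y) (*-pos (x<0⇒0<-x x<0) (x<0⇒0<-x y<0))
    where
    -x*-y≡x*y : ∀ x y → - x * - y ≡ x * y
    -x*-y≡x*y = solve 2 (λ x y → :- x :* :- y := x :* y) refl

  *-nonpos-nonpos : ∀ {x y} → x ≤ 0# → y ≤ 0# → 0# ≤ x * y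
  *-nonpos-nonpos (inj₁ x<0) (inj₁ y<0) = inj₁ (*-neg-neg x<0 y<0)
  *-nonpos-nonpos {x} _ (inj₂ refl) = inj₂ (sym (zeroʳ x))
  *-nonpos-nonpos (inj₂ refl) _ = inj₂ (sym (zeroˡ _))

  x⁻¹-pos : ∀ {x} → 0# < x → 0# < x ⁻¹
  x⁻¹-pos {x} 0<x = from-compare (compare 0# (x ⁻¹))
    where
    x*x⁻¹≡1 : x * x ⁻¹ ≡ 1#
    x*x⁻¹≡1 = ⁻¹-inverse x (>⇒≢ 0<x)
    from-compare : Tri (0# < x ⁻¹) (0# ≡ x ⁻¹) (x ⁻¹ < 0#) → 0# < x ⁻¹
    from-compare (tri< 0<x⁻¹ _ _) = 0<x⁻¹
    from-compare (tri≈ _ 0≡x⁻¹ _) = ⊥-elim (0≢1 (trans (sym (zeroʳ x)) (trans (cong (x *_) 0≡x⁻¹) x*x⁻¹≡1)))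
    from-compare (tri> _ _ x⁻¹<0) = ⊥-elim (<-asym 0<1 (subst (_< 0#) x*x⁻¹≡1 (*-pos-neg 0<x x⁻¹<0)))

  x*y≡0⇒y≡0 : ∀ {x y} → ¬ (x ≡ 0#) → x * y ≡ 0# → y ≡ 0#
  x*y≡0⇒y≡0 {x} {y} x≢0 xy≡0 = begin
    y               ≡⟨ *-identityˡ y ⟨
    1# * y          ≡⟨ cong (_* y) (trans (*-comm _ x) (⁻¹-inverse x x≢0)) ⟨
    x ⁻¹ * x * y    ≡⟨ *-assoc _ _ _ ⟩
    x ⁻¹ * (x * y)  ≡⟨ cong (x ⁻¹ *_) xy≡0 ⟩
    x ⁻¹ * 0#       ≡⟨ zeroʳ _ ⟩
    0#              ∎
    where open ≡-Reasoning

  fromℕ-nonneg : ∀ n → 0# ≤ fromℕ n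
  fromℕ-nonneg zero    = ≤-refl
  fromℕ-nonneg (suc n) = inj₁ (+-pos-nonneg 0<1 (fromℕ-nonneg n))

  fromℕ-suc-pos : ∀ n → 0# < fromℕ (suc n)
  fromℕ-suc-pos n = +-pos-nonneg 0<1 (fromℕ-nonneg n)

  1/[1+_] : ℕ → Carrier
  1/[1+ n ] = fromℕ (suc n) ⁻¹

  1/[1+n]-pos : ∀ n → 0# < 1/[1+ n ]
  1/[1+n]-pos n = x⁻¹-pos (fromℕ-suc-pos n)

  [1+n]*1/[1+n]≡1 : ∀ n → fromℕ (suc n) * 1/[1+ n ] ≡ 1#
  [1+n]*1/[1+n]≡1 n = ⁻¹-inverse _ (>⇒≢ (fromℕ-suc-pos n))

  1/[1+0]≡1 : 1/[1+ 0 ] ≡ 1#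
  1/[1+0]≡1 = begin
    1/[1+ 0 ]            ≡⟨ *-identityˡ _ ⟨
    1# * 1/[1+ 0 ]       ≡⟨ cong (_* 1/[1+ 0 ]) (+-identityʳ 1#) ⟨
    fromℕ 1 * 1/[1+ 0 ]  ≡⟨ [1+n]*1/[1+n]≡1 0 ⟩
    1#                   ∎
    where open ≡-Reasoning

  x<1+x : ∀ x → x < 1# + x
  x<1+x x = subst (_< 1# + x) (+-identityˡ x) (+-monoʳ-< x 0<1)

  1/[1+n]-decreasing : ∀ n → 1/[1+ suc n ] < 1/[1+ n ]
  1/[1+n]-decreasing n = subst₂ _<_ ab[1+n]≡b ab[2+n]≡a
    (*-monoˡ-< (*-pos (1/[1+n]-pos n) (1/[1+n]-pos (suc n))) (x<1+x (fromℕ (suc n))))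
    where
    a b : Carrier
    a = 1/[1+ n ]
    b = 1/[1+ suc n ]
    ab[1+n]≡b : a * b * fromℕ (suc n) ≡ b
    ab[1+n]≡b = trans (solve 3 (λ x y z → x :* y :* z := y :* (z :* x)) refl a b _)
                      (trans (cong (b *_) ([1+n]*1/[1+n]≡1 n)) (*-identityʳ b))
    ab[2+n]≡a : a * b * fromℕ (suc (suc n)) ≡ a
    ab[2+n]≡a = trans (solve 3 (λ x y z → x :* y :* z := x :* (z :* y)) refl a b _)
                      (trans (cong (a *_) ([1+n]*1/[1+n]≡1 (suc n))) (*-identityʳ a))

  infixr 8 _^_
  _^_ : Carrier → ℕ → Carrier
  x ^ zero  = 1#
  x ^ suc n = x * x ^ n

  ^-distribʳ-* : ∀ x y n → (x * y) ^ n ≡ x ^ n * y ^ n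
  ^-distribʳ-* x y zero    = sym (*-identityʳ 1#)
  ^-distribʳ-* x y (suc n) = trans (cong (x * y *_) (^-distribʳ-* x y n))
    (solve 4 (λ x y a b → x :* y :* (a :* b) := x :* a :* (y :* b)) refl x y (x ^ n) (y ^ n))

  ^-nonzero : ∀ {x} n → ¬ (x ≡ 0#) → ¬ (x ^ n ≡ 0#)
  ^-nonzero zero    _   1≡0  = 0≢1 (sym 1≡0)
  ^-nonzero (suc n) x≢0 xxⁿ≡0 = ^-nonzero n x≢0 (x*y≡0⇒y≡0 x≢0 xxⁿ≡0)

  ^-nonneg : ∀ {x} n → 0# ≤ x → 0# ≤ x ^ n
  ^-nonneg zero    _   = inj₁ 0<1
  ^-nonneg (suc n) 0≤x = *-nonneg 0≤x (^-nonneg n 0≤x)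

  ^-pos : ∀ {x} n → 0# < x → 0# < x ^ n
  ^-pos zero    _   = 0<1
  ^-pos (suc n) 0<x = *-pos 0<x (^-pos n 0<x)

  ^-odd-neg : ∀ {x} k → x < 0# → x ^ suc (k ℕ.* 2) < 0#
  ^-odd-neg zero    x<0 = subst (_< 0#) (sym (*-identityʳ _)) x<0
  ^-odd-neg (suc k) x<0 = *-neg-pos x<0 (*-neg-neg x<0 (^-odd-neg k x<0))

  -x^even≡x^even : ∀ x k → (- x) ^ (k ℕ.* 2) ≡ x ^ (k ℕ.* 2)
  -x^even≡x^even x zero    = refl
  -x^even≡x^even x (suc k) = trans (cong (λ y → - x * (- x * y)) (-x^even≡x^even x k))
    (solve 2 (λ x y → :- x :* (:- x :* y) := x :* (x :* y)) refl x (x ^ (k ℕ.* 2)))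

  -x^odd≡-x^odd : ∀ x k → (- x) ^ suc (k ℕ.* 2) ≡ - (x ^ suc (k ℕ.* 2))
  -x^odd≡-x^odd x k = trans (cong (- x *_) (-x^even≡x^even x k)) (sym (-‿distribˡ-* _ _))

  ∣_∣ : Carrier → Carrier
  ∣ x ∣ with ≤-<-cases 0# x
  ... | inj₁ _ = x
  ... | inj₂ _ = - x

  0≤x⇒∣x∣≡x : ∀ {x} → 0# ≤ x → ∣ x ∣ ≡ x
  0≤x⇒∣x∣≡x {x} 0≤x with ≤-<-cases 0# x
  ... | inj₁ _   = refl
  ... | inj₂ x<0 = ⊥-elim (<⇒≱ x<0 0≤x)

  x≤0⇒∣x∣≡-x : ∀ {x} → x ≤ 0# → ∣ x ∣ ≡ - x
  x≤0⇒∣x∣≡-x {x} x≤0 with ≤-<-cases 0# x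
  ... | inj₁ 0≤x = trans x≡0 (trans (sym -0#≈0#) (cong -_ (sym x≡0)))
    where
    x≡0 : x ≡ 0#
    x≡0 = ≤-antisym x≤0 0≤x
  ... | inj₂ _   = refl

  ∣x∣-nonneg : ∀ x → 0# ≤ ∣ x ∣
  ∣x∣-nonneg x with ≤-<-cases 0# x
  ... | inj₁ 0≤x = 0≤x
  ... | inj₂ x<0 = inj₁ (x<0⇒0<-x x<0)

  x≤∣x∣ : ∀ x → x ≤ ∣ x ∣
  x≤∣x∣ x with ≤-<-cases 0# x
  ... | inj₁ _   = ≤-refl
  ... | inj₂ x<0 = inj₁ (<-trans x<0 (x<0⇒0<-x x<0))

  -x≤∣x∣ : ∀ x → - x ≤ ∣ x ∣
  -x≤∣x∣ x with ≤-<-cases 0# x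
  ... | inj₁ 0≤x = ≤-trans (0≤x⇒-x≤0 0≤x) 0≤x
  ... | inj₂ _   = ≤-refl

  ∣x∣≤c : ∀ {x c} → x ≤ c → - x ≤ c → ∣ x ∣ ≤ c
  ∣x∣≤c {x} x≤c -x≤c with ≤-<-cases 0# x
  ... | inj₁ _ = x≤c
  ... | inj₂ _ = -x≤c

  ∣x+y∣≤∣x∣+∣y∣ : ∀ x y → ∣ x + y ∣ ≤ ∣ x ∣ + ∣ y ∣
  ∣x+y∣≤∣x∣+∣y∣ x y = ∣x∣≤c (+-mono-≤ (x≤∣x∣ x) (x≤∣x∣ y))
    (subst (_≤ ∣ x ∣ + ∣ y ∣) (-‿+-comm x y) (+-mono-≤ (-x≤∣x∣ x) (-x≤∣x∣ y)))

  ∣x*y∣≡∣x∣*∣y∣ : ∀ x y → ∣ x * y ∣ ≡ ∣ x ∣ * ∣ y ∣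
  ∣x*y∣≡∣x∣*∣y∣ x y = by-signs (≤-<-cases x 0#) (≤-<-cases y 0#)
    where
    open ≡-Reasoning
    by-signs : x ≤ 0# ⊎ 0# < x → y ≤ 0# ⊎ 0# < y → ∣ x * y ∣ ≡ ∣ x ∣ * ∣ y ∣
    by-signs (inj₁ x≤0) (inj₁ y≤0) = begin
      ∣ x * y ∣      ≡⟨ 0≤x⇒∣x∣≡x (*-nonpos-nonpos x≤0 y≤0) ⟩
      x * y          ≡⟨ solve 2 (λ x y → x :* y := :- x :* :- y) refl x y ⟩
      - x * - y      ≡⟨ cong₂ _*_ (x≤0⇒∣x∣≡-x x≤0) (x≤0⇒∣x∣≡-x y≤0) ⟨
      ∣ x ∣ * ∣ y ∣  ∎
    by-signs (inj₁ x≤0) (inj₂ 0<y) = begin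
      ∣ x * y ∣      ≡⟨ x≤0⇒∣x∣≡-x (subst (_≤ 0#) (*-comm y x) (*-nonneg-nonpos (inj₁ 0<y) x≤0)) ⟩
      - (x * y)      ≡⟨ -‿distribˡ-* x y ⟩
      - x * y        ≡⟨ cong₂ _*_ (x≤0⇒∣x∣≡-x x≤0) (0≤x⇒∣x∣≡x (inj₁ 0<y)) ⟨
      ∣ x ∣ * ∣ y ∣  ∎
    by-signs (inj₂ 0<x) (inj₁ y≤0) = begin
      ∣ x * y ∣      ≡⟨ x≤0⇒∣x∣≡-x (*-nonneg-nonpos (inj₁ 0<x) y≤0) ⟩
      - (x * y)      ≡⟨ -‿distribʳ-* x y ⟩
      x * - y        ≡⟨ cong₂ _*_ (0≤x⇒∣x∣≡x (inj₁ 0<x)) (x≤0⇒∣x∣≡-x y≤0) ⟨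
      ∣ x ∣ * ∣ y ∣  ∎
    by-signs (inj₂ 0<x) (inj₂ 0<y) = begin
      ∣ x * y ∣      ≡⟨ 0≤x⇒∣x∣≡x (inj₁ (*-pos 0<x 0<y)) ⟩
      x * y          ≡⟨ cong₂ _*_ (0≤x⇒∣x∣≡x (inj₁ 0<x)) (0≤x⇒∣x∣≡x (inj₁ 0<y)) ⟨
      ∣ x ∣ * ∣ y ∣  ∎

  ⁻¹-distrib-* : ∀ {x y} → ¬ (x ≡ 0#) → ¬ (y ≡ 0#) → (x * y) ⁻¹ ≡ x ⁻¹ * y ⁻¹
  ⁻¹-distrib-* {x} {y} x≢0 y≢0 = begin
    (x * y) ⁻¹                              ≡⟨ *-identityʳ _ ⟨
    (x * y) ⁻¹ * 1#
      ≡⟨ cong ((x * y) ⁻¹ *_) (trans (cong₂ _*_ (⁻¹-inverse x x≢0) (⁻¹-inverse y y≢0)) (*-identityʳ 1#)) ⟨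
    (x * y) ⁻¹ * ((x * x ⁻¹) * (y * y ⁻¹))
      ≡⟨ solve 5 (λ z x y i j → z :* ((x :* i) :* (y :* j)) := (i :* j) :* ((x :* y) :* z))
                 refl ((x * y) ⁻¹) x y (x ⁻¹) (y ⁻¹) ⟩
    (x ⁻¹ * y ⁻¹) * ((x * y) * (x * y) ⁻¹)  ≡⟨ cong ((x ⁻¹ * y ⁻¹) *_) (⁻¹-inverse (x * y) xy≢0) ⟩
    (x ⁻¹ * y ⁻¹) * 1#                      ≡⟨ *-identityʳ _ ⟩
    x ⁻¹ * y ⁻¹                             ∎
    where
    open ≡-Reasoning
    xy≢0 : ¬ (x * y ≡ 0#)
    xy≢0 xy≡0 = x≢0 (x*y≡0⇒y≡0 y≢0 (trans (*-comm y x) xy≡0))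

  cross-multiply : ∀ {a b c d} → ¬ (c ≡ 0#) → ¬ (d ≡ 0#) → a * d ≡ b * c → a * c ⁻¹ ≡ b * d ⁻¹
  cross-multiply {a} {b} {c} {d} c≢0 d≢0 ad≡bc = begin
    a * c ⁻¹                 ≡⟨ *-identityʳ _ ⟨
    a * c ⁻¹ * 1#            ≡⟨ cong (a * c ⁻¹ *_) (⁻¹-inverse d d≢0) ⟨
    a * c ⁻¹ * (d * d ⁻¹)    ≡⟨ solve 4 (λ a i d j → a :* i :* (d :* j) := (a :* d) :* (i :* j)) refl a (c ⁻¹) d (d ⁻¹) ⟩
    (a * d) * (c ⁻¹ * d ⁻¹)  ≡⟨ cong (_* (c ⁻¹ * d ⁻¹)) ad≡bc ⟩
    (b * c) * (c ⁻¹ * d ⁻¹)  ≡⟨ solve 4 (λ b c i j → (b :* c) :* (i :* j) := b :* j :* (c :* i)) refl b c (c ⁻¹) (d ⁻¹) ⟩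
    b * d ⁻¹ * (c * c ⁻¹)    ≡⟨ cong (b * d ⁻¹ *_) (⁻¹-inverse c c≢0) ⟩
    b * d ⁻¹ * 1#            ≡⟨ *-identityʳ _ ⟩
    b * d ⁻¹                 ∎
    where open ≡-Reasoning

  x*[y*x⁻¹]≡y : ∀ {x} y → ¬ (x ≡ 0#) → x * (y * x ⁻¹) ≡ y
  x*[y*x⁻¹]≡y {x} y x≢0 = trans (solve 3 (λ x y i → x :* (y :* i) := y :* (x :* i)) refl x y (x ⁻¹))
                                (trans (cong (y *_) (⁻¹-inverse x x≢0)) (*-identityʳ y))

  x-y≡0⇒x≡y : ∀ {x y} → x - y ≡ 0# → x ≡ y
  x-y≡0⇒x≡y {x} {y} x-y≡0 = begin
    x            ≡⟨ solve 2 (λ x y → x := (x :- y) :+ y) refl x y ⟩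
    (x - y) + y  ≡⟨ cong (_+ y) x-y≡0 ⟩
    0# + y       ≡⟨ +-identityˡ y ⟩
    y            ∎
    where open ≡-Reasoning

  *-cancelʳ : ∀ {x y z} → ¬ (z ≡ 0#) → x * z ≡ y * z → x ≡ y
  *-cancelʳ {x} {y} {z} z≢0 xz≡yz = x-y≡0⇒x≡y (x*y≡0⇒y≡0 z≢0 (begin
    z * (x - y)    ≡⟨ solve 3 (λ x y z → z :* (x :- y) := x :* z :- y :* z) refl x y z ⟩
    x * z - y * z  ≡⟨ cong (_- y * z) xz≡yz ⟩
    y * z - y * z  ≡⟨ -‿inverseʳ (y * z) ⟩
    0#             ∎))
    where open ≡-Reasoning

module RationalEmbedding (R : RealField) where

  open OrderedFieldProperties R
  open import Data.Nat as ℕ using (suc)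
  import Data.Integer as ℤ
  open import Data.Rational as ℚ using (ℚ; mkℚ)
  import Data.Rational.Properties as ℚ
  open import Data.Rational.Unnormalised as ℚᵘ using (ℚᵘ; mkℚᵘ; *≡*)
  open import Relation.Binary.PropositionalEquality
  open import Relation.Nullary using (¬_)

  fromℚᵘ : ℚᵘ → Carrier
  fromℚᵘ p = fromℤ (ℚᵘ.numerator p) * 1/[1+ ℚᵘ.denominator-1 p ]

  fromℚ≡fromℚᵘ∘toℚᵘ : ∀ q → fromℚ q ≡ fromℚᵘ (ℚ.toℚᵘ q)
  fromℚ≡fromℚᵘ∘toℚᵘ (mkℚ _ _ _) = refl

  fromℕ-suc≢0 : ∀ n → ¬ (fromℕ (suc n) ≡ 0#)
  fromℕ-suc≢0 n = >⇒≢ (fromℕ-suc-pos n)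

  fromℚᵘ-cong : ∀ {p q} → p ℚᵘ.≃ q → fromℚᵘ p ≡ fromℚᵘ q
  fromℚᵘ-cong {p} {q} (*≡* eq) = cross-multiply (fromℕ-suc≢0 (ℚᵘ.denominator-1 p)) (fromℕ-suc≢0 (ℚᵘ.denominator-1 q))
    (trans (sym (fromℤ-* (ℚᵘ.numerator p) (ℚᵘ.denominator q)))
      (trans (cong fromℤ eq) (fromℤ-* (ℚᵘ.numerator q) (ℚᵘ.denominator p))))

  fromℚᵘ-+ : ∀ p q → fromℚᵘ (p ℚᵘ.+ q) ≡ fromℚᵘ p + fromℚᵘ q
  fromℚᵘ-+ (mkℚᵘ n₁ d₁) (mkℚᵘ n₂ d₂) = begin
    fromℤ (n₁ ℤ.* ℤ.+ suc d₂ ℤ.+ n₂ ℤ.* ℤ.+ suc d₁) * fromℕ (suc d₁ ℕ.* suc d₂) ⁻¹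
      ≡⟨ cong₂ (λ u v → u * v ⁻¹)
           (trans (fromℤ-+ (n₁ ℤ.* ℤ.+ suc d₂) _) (cong₂ _+_ (fromℤ-* n₁ (ℤ.+ suc d₂)) (fromℤ-* n₂ (ℤ.+ suc d₁))))
           (fromℕ-* (suc d₁) (suc d₂)) ⟩
    (a * D₂ + b * D₁) * (D₁ * D₂) ⁻¹
      ≡⟨ cong ((a * D₂ + b * D₁) *_) (⁻¹-distrib-* (fromℕ-suc≢0 d₁) (fromℕ-suc≢0 d₂)) ⟩
    (a * D₂ + b * D₁) * (D₁ ⁻¹ * D₂ ⁻¹)
      ≡⟨ solve 6 (λ a b D₁ D₂ i j → (a :* D₂ :+ b :* D₁) :* (i :* j) := a :* i :* (D₂ :* j) :+ b :* j :* (D₁ :* i))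
                 refl a b D₁ D₂ (D₁ ⁻¹) (D₂ ⁻¹) ⟩
    a * D₁ ⁻¹ * (D₂ * D₂ ⁻¹) + b * D₂ ⁻¹ * (D₁ * D₁ ⁻¹)
      ≡⟨ cong₂ (λ u v → a * D₁ ⁻¹ * u + b * D₂ ⁻¹ * v) ([1+n]*1/[1+n]≡1 d₂) ([1+n]*1/[1+n]≡1 d₁) ⟩
    a * D₁ ⁻¹ * 1# + b * D₂ ⁻¹ * 1#
      ≡⟨ cong₂ _+_ (*-identityʳ _) (*-identityʳ _) ⟩
    a * D₁ ⁻¹ + b * D₂ ⁻¹ ∎
    where
    open ≡-Reasoning
    a b D₁ D₂ : Carrier
    a = fromℤ n₁
    b = fromℤ n₂
    D₁ = fromℕ (suc d₁)
    D₂ = fromℕ (suc d₂)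

  fromℚᵘ-* : ∀ p q → fromℚᵘ (p ℚᵘ.* q) ≡ fromℚᵘ p * fromℚᵘ q
  fromℚᵘ-* (mkℚᵘ n₁ d₁) (mkℚᵘ n₂ d₂) = begin
    fromℤ (n₁ ℤ.* n₂) * fromℕ (suc d₁ ℕ.* suc d₂) ⁻¹
      ≡⟨ cong₂ (λ u v → u * v ⁻¹) (fromℤ-* n₁ n₂) (fromℕ-* (suc d₁) (suc d₂)) ⟩
    (a * b) * (D₁ * D₂) ⁻¹
      ≡⟨ cong ((a * b) *_) (⁻¹-distrib-* (fromℕ-suc≢0 d₁) (fromℕ-suc≢0 d₂)) ⟩
    (a * b) * (D₁ ⁻¹ * D₂ ⁻¹)
      ≡⟨ solve 4 (λ a b i j → (a :* b) :* (i :* j) := (a :* i) :* (b :* j)) refl a b (D₁ ⁻¹) (D₂ ⁻¹) ⟩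
    a * D₁ ⁻¹ * (b * D₂ ⁻¹) ∎
    where
    open ≡-Reasoning
    a b D₁ D₂ : Carrier
    a = fromℤ n₁
    b = fromℤ n₂
    D₁ = fromℕ (suc d₁)
    D₂ = fromℕ (suc d₂)

  fromℚᵘ-neg : ∀ p → fromℚᵘ (ℚᵘ.- p) ≡ - fromℚᵘ p
  fromℚᵘ-neg (mkℚᵘ n d) = trans (cong (_* 1/[1+ d ]) (fromℤ-neg n)) (sym (-‿distribˡ-* _ _))

  fromℚ-+ : ∀ p q → fromℚ (p ℚ.+ q) ≡ fromℚ p + fromℚ q
  fromℚ-+ p q = begin
    fromℚ (p ℚ.+ q)                        ≡⟨ fromℚ≡fromℚᵘ∘toℚᵘ (p ℚ.+ q) ⟩
    fromℚᵘ (ℚ.toℚᵘ (p ℚ.+ q))              ≡⟨ fromℚᵘ-cong (ℚ.toℚᵘ-homo-+ p q) ⟩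
    fromℚᵘ (ℚ.toℚᵘ p ℚᵘ.+ ℚ.toℚᵘ q)        ≡⟨ fromℚᵘ-+ (ℚ.toℚᵘ p) (ℚ.toℚᵘ q) ⟩
    fromℚᵘ (ℚ.toℚᵘ p) + fromℚᵘ (ℚ.toℚᵘ q)  ≡⟨ cong₂ _+_ (fromℚ≡fromℚᵘ∘toℚᵘ p) (fromℚ≡fromℚᵘ∘toℚᵘ q) ⟨
    fromℚ p + fromℚ q                      ∎
    where open ≡-Reasoning

  fromℚ-* : ∀ p q → fromℚ (p ℚ.* q) ≡ fromℚ p * fromℚ q
  fromℚ-* p q = begin
    fromℚ (p ℚ.* q)                        ≡⟨ fromℚ≡fromℚᵘ∘toℚᵘ (p ℚ.* q) ⟩
    fromℚᵘ (ℚ.toℚᵘ (p ℚ.* q))              ≡⟨ fromℚᵘ-cong (ℚ.toℚᵘ-homo-* p q) ⟩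
    fromℚᵘ (ℚ.toℚᵘ p ℚᵘ.* ℚ.toℚᵘ q)        ≡⟨ fromℚᵘ-* (ℚ.toℚᵘ p) (ℚ.toℚᵘ q) ⟩
    fromℚᵘ (ℚ.toℚᵘ p) * fromℚᵘ (ℚ.toℚᵘ q)  ≡⟨ cong₂ _*_ (fromℚ≡fromℚᵘ∘toℚᵘ p) (fromℚ≡fromℚᵘ∘toℚᵘ q) ⟨
    fromℚ p * fromℚ q                      ∎
    where open ≡-Reasoning

  fromℚ-neg : ∀ p → fromℚ (ℚ.- p) ≡ - fromℚ p
  fromℚ-neg p = begin
    fromℚ (ℚ.- p)            ≡⟨ fromℚ≡fromℚᵘ∘toℚᵘ (ℚ.- p) ⟩
    fromℚᵘ (ℚ.toℚᵘ (ℚ.- p))  ≡⟨ fromℚᵘ-cong (ℚ.toℚᵘ-homo‿- p) ⟩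
    fromℚᵘ (ℚᵘ.- ℚ.toℚᵘ p)   ≡⟨ fromℚᵘ-neg (ℚ.toℚᵘ p) ⟩
    - fromℚᵘ (ℚ.toℚᵘ p)      ≡⟨ cong -_ (fromℚ≡fromℚᵘ∘toℚᵘ p) ⟨
    - fromℚ p                ∎
    where open ≡-Reasoning

  fromℚ-/ : ∀ i m → fromℚ (i ℚ./ suc m) ≡ fromℤ i * 1/[1+ m ]
  fromℚ-/ i m = trans (fromℚ≡fromℚᵘ∘toℚᵘ (i ℚ./ suc m)) (fromℚᵘ-cong (ℚ.toℚᵘ-fromℚᵘ (mkℚᵘ i m)))

module IntermediateValue (R : RealField) where

  open OrderedFieldProperties R
  open import Data.Rational using (ℚ)
  open import Data.List using (List; []; _∷_)
  open import Data.Product using (Σ; _×_; _,_; proj₁; proj₂)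
  open import Data.Sum using (inj₁; inj₂)
  open import Data.Empty using (⊥-elim)
  open import Relation.Binary.PropositionalEquality
  open import Relation.Nullary using (¬_)
  open import Relation.Binary.Definitions using (tri<; tri≈; tri>)
  import Data.Integer as ℤ

  coeffNorm : List ℚ → Carrier
  coeffNorm []       = 0#
  coeffNorm (a ∷ as) = ∣ fromℚ a ∣ + coeffNorm as

  lipschitzConstant : List ℚ → Carrier
  lipschitzConstant []       = 0#
  lipschitzConstant (a ∷ as) = coeffNorm as + lipschitzConstant as

  coeffNorm-nonneg : ∀ cs → 0# ≤ coeffNorm cs
  coeffNorm-nonneg []       = ≤-refl
  coeffNorm-nonneg (a ∷ as) = +-nonneg-nonneg (∣x∣-nonneg _) (coeffNorm-nonneg as)

  lipschitzConstant-nonneg : ∀ cs → 0# ≤ lipschitzConstant cs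
  lipschitzConstant-nonneg []       = ≤-refl
  lipschitzConstant-nonneg (a ∷ as) = +-nonneg-nonneg (coeffNorm-nonneg as) (lipschitzConstant-nonneg as)

  ∣eval∣≤coeffNorm : ∀ cs {y} → ∣ y ∣ ≤ 1# → ∣ eval cs y ∣ ≤ coeffNorm cs
  ∣eval∣≤coeffNorm []       _ = inj₂ (0≤x⇒∣x∣≡x ≤-refl)
  ∣eval∣≤coeffNorm (a ∷ as) {y} ∣y∣≤1 = begin
    ∣ fromℚ a + y * eval as y ∣          ≤⟨ ∣x+y∣≤∣x∣+∣y∣ _ _ ⟩
    ∣ fromℚ a ∣ + ∣ y * eval as y ∣      ≡⟨ cong (∣ fromℚ a ∣ +_) (∣x*y∣≡∣x∣*∣y∣ y _) ⟩
    ∣ fromℚ a ∣ + ∣ y ∣ * ∣ eval as y ∣  ≤⟨ +-monoˡ-≤ ∣ fromℚ a ∣ (*-monoʳ-≤ (∣x∣-nonneg _) ∣y∣≤1) ⟩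
    ∣ fromℚ a ∣ + 1# * ∣ eval as y ∣     ≡⟨ cong (∣ fromℚ a ∣ +_) (*-identityˡ _) ⟩
    ∣ fromℚ a ∣ + ∣ eval as y ∣          ≤⟨ +-monoˡ-≤ ∣ fromℚ a ∣ (∣eval∣≤coeffNorm as ∣y∣≤1) ⟩
    coeffNorm (a ∷ as)                   ∎
    where open import Relation.Binary.Reasoning.StrictPartialOrder strictPartialOrder

  eval-lipschitz : ∀ cs {y z} → ∣ y ∣ ≤ 1# → ∣ z ∣ ≤ 1# →
    ∣ eval cs y - eval cs z ∣ ≤ lipschitzConstant cs * ∣ y - z ∣
  eval-lipschitz []       {y} {z} _ _ = inj₂ (trans (cong ∣_∣ (-‿inverseʳ 0#)) (trans (0≤x⇒∣x∣≡x ≤-refl) (sym (zeroˡ _))))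
  eval-lipschitz (a ∷ as) {y} {z} ∣y∣≤1 ∣z∣≤1 = begin
    ∣ (A + y * Ey) - (A + z * Ez) ∣
      ≡⟨ cong ∣_∣ (solve 5 (λ A y z Ey Ez → (A :+ y :* Ey) :- (A :+ z :* Ez) := (y :- z) :* Ey :+ z :* (Ey :- Ez)) refl A y z Ey Ez) ⟩
    ∣ (y - z) * Ey + z * (Ey - Ez) ∣
      ≤⟨ ∣x+y∣≤∣x∣+∣y∣ _ _ ⟩
    ∣ (y - z) * Ey ∣ + ∣ z * (Ey - Ez) ∣
      ≡⟨ cong₂ _+_ (∣x*y∣≡∣x∣*∣y∣ _ _) (∣x*y∣≡∣x∣*∣y∣ _ _) ⟩
    ∣ y - z ∣ * ∣ Ey ∣ + ∣ z ∣ * ∣ Ey - Ez ∣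
      ≤⟨ +-mono-≤ (*-monoˡ-≤ (∣x∣-nonneg _) (∣eval∣≤coeffNorm as ∣y∣≤1)) (*-monoʳ-≤ (∣x∣-nonneg _) ∣z∣≤1) ⟩
    ∣ y - z ∣ * coeffNorm as + 1# * ∣ Ey - Ez ∣
      ≤⟨ +-monoˡ-≤ _ (subst (_≤ lipschitzConstant as * ∣ y - z ∣) (sym (*-identityˡ _)) (eval-lipschitz as ∣y∣≤1 ∣z∣≤1)) ⟩
    ∣ y - z ∣ * coeffNorm as + lipschitzConstant as * ∣ y - z ∣
      ≡⟨ solve 3 (λ d M L → d :* M :+ L :* d := (M :+ L) :* d) refl ∣ y - z ∣ (coeffNorm as) (lipschitzConstant as) ⟩
    (coeffNorm as + lipschitzConstant as) * ∣ y - z ∣ ∎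
    where
    open import Relation.Binary.Reasoning.StrictPartialOrder strictPartialOrder
    A Ey Ez : Carrier
    A = fromℚ a
    Ey = eval as y
    Ez = eval as z

  min-pos : ∀ {d e} → 0# < d → 0# < e → Σ Carrier λ η → 0# < η × η ≤ d × η ≤ e
  min-pos {d} {e} 0<d 0<e with ≤-<-cases d e
  ... | inj₁ d≤e = d , 0<d , ≤-refl , d≤e
  ... | inj₂ e<d = e , 0<e , inj₁ e<d , ≤-refl

  module _ (p : Carrier → Carrier) {a b L : Carrier} (a≤b : a ≤ b) (0≤L : 0# ≤ L)
           (lipschitz : ∀ {y z} → a ≤ y → y ≤ b → a ≤ z → z ≤ b → ∣ p y - p z ∣ ≤ L * ∣ y - z ∣)
           (pa<0 : p a < 0#) (0<pb : 0# < p b) where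

    private
      Below : Carrier → Set
      Below x = a ≤ x × x ≤ b × p x < 0#

      L′ : Carrier
      L′ = L + 1#

      0<L′ : 0# < L′
      0<L′ = +-nonneg-pos 0≤L 0<1

      -- For c = sup Below: if p c < 0 then p stays negative just right of c, and if
      -- p c > 0 then it stays positive on some (c - η, c], making c - η an upper bound.
      module Supremum (c : Carrier) (upper : IsUpperBound Below c)
                      (least : ∀ u → IsUpperBound Below u → c ≤ u) where

        a≤c : a ≤ c
        a≤c = upper a (≤-refl , a≤b , pa<0)

        c≤b : c ≤ b
        c≤b = least b (λ _ below → proj₁ (proj₂ below))

        near-c : ∀ {x ε} → a ≤ x → x ≤ b → 0# < ε → ∣ x - c ∣ ≤ ε * L′ ⁻¹ → ∣ p x - p c ∣ < ε
        near-c {x} {ε} a≤x x≤b 0<ε ∣x-c∣≤ = begin-strict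
          ∣ p x - p c ∣     ≤⟨ lipschitz a≤x x≤b a≤c c≤b ⟩
          L * ∣ x - c ∣     ≤⟨ *-monoˡ-≤ 0≤L ∣x-c∣≤ ⟩
          L * (ε * L′ ⁻¹)   <⟨ *-monoʳ-< (*-pos 0<ε (x⁻¹-pos 0<L′)) (subst (_< L′) (+-identityʳ L) (+-monoˡ-< L 0<1)) ⟩
          L′ * (ε * L′ ⁻¹)  ≡⟨ x*[y*x⁻¹]≡y ε (>⇒≢ 0<L′) ⟩
          ε                 ∎
          where open import Relation.Binary.Reasoning.StrictPartialOrder strictPartialOrder

        p[c]≮0 : ¬ (p c < 0#)
        p[c]≮0 pc<0 with c≤b
        ... | inj₂ refl = <-asym 0<pb pc<0
        ... | inj₁ c<b with min-pos (*-pos (x<0⇒0<-x pc<0) (x⁻¹-pos 0<L′)) (x<y⇒0<y-x c<b)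
        ...   | η , 0<η , η≤ε/L′ , η≤b-c = <⇒≱ c<c+η (upper (c + η) (a≤c+η , c+η≤b , p[c+η]<0))
          where
          c<c+η : c < c + η
          c<c+η = subst (_< c + η) (+-identityʳ c) (+-monoˡ-< c 0<η)
          a≤c+η : a ≤ c + η
          a≤c+η = ≤-trans a≤c (inj₁ c<c+η)
          c+η≤b : c + η ≤ b
          c+η≤b = subst (c + η ≤_) (x+[y-x]≡y c b) (+-monoˡ-≤ c η≤b-c)
          ∣c+η-c∣≡η : ∣ c + η - c ∣ ≡ η
          ∣c+η-c∣≡η = trans (cong ∣_∣ (solve 2 (λ c η → c :+ η :- c := η) refl c η)) (0≤x⇒∣x∣≡x (inj₁ 0<η))
          p[c+η]<0 : p (c + η) < 0#
          p[c+η]<0 = subst₂ _<_ (solve 2 (λ u v → u :- v :+ v := u) refl (p (c + η)) (p c))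
                                (solve 1 (λ v → :- v :+ v := :0) refl (p c))
            (+-monoʳ-< (p c) (≤-<-trans (x≤∣x∣ _)
              (near-c a≤c+η c+η≤b (x<0⇒0<-x pc<0) (subst (_≤ _) (sym ∣c+η-c∣≡η) η≤ε/L′))))

        p[c]≯0 : ¬ (0# < p c)
        p[c]≯0 0<pc with a≤c
        ... | inj₂ refl = <-asym 0<pc pa<0
        ... | inj₁ a<c with min-pos (*-pos 0<pc (x⁻¹-pos 0<L′)) (x<y⇒0<y-x a<c)
        ...   | η , 0<η , η≤ε/L′ , η≤c-a = <⇒≱ c-η<c (least (c - η) c-η-upper)
          where
          c-η<c : c - η < c
          c-η<c = subst₂ _<_ (+-comm (- η) c) (+-identityˡ c) (+-monoʳ-< c (0<x⇒-x<0 0<η))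
          c-η-upper : IsUpperBound Below (c - η)
          c-η-upper x (a≤x , x≤b , px<0) with ≤-<-cases x (c - η)
          ... | inj₁ x≤c-η = x≤c-η
          ... | inj₂ c-η<x = ⊥-elim (<-asym px<0 0<px)
            where
            c-x<η : c - x < η
            c-x<η = subst₂ _<_ (solve 3 (λ c η x → c :- η :+ (η :- x) := c :- x) refl c η x)
                               (solve 2 (λ η x → x :+ (η :- x) := η) refl η x)
                               (+-monoʳ-< (η - x) c-η<x)
            ∣x-c∣≡c-x : ∣ x - c ∣ ≡ c - x
            ∣x-c∣≡c-x = trans (x≤0⇒∣x∣≡-x (subst (x - c ≤_) (-‿inverseʳ c) (+-monoʳ-≤ (- c) (upper x (a≤x , x≤b , px<0)))))
                              (solve 2 (λ x c → :- (x :- c) := c :- x) refl x c)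
            pc-px<pc : p c - p x < p c
            pc-px<pc = ≤-<-trans (subst (_≤ ∣ p x - p c ∣) (solve 2 (λ u v → :- (u :- v) := v :- u) refl (p x) (p c)) (-x≤∣x∣ _))
                                 (near-c a≤x x≤b 0<pc (subst (_≤ _) (sym ∣x-c∣≡c-x) (inj₁ (<-≤-trans c-x<η η≤ε/L′))))
            0<px : 0# < p x
            0<px = subst₂ _<_ (-‿inverseʳ (p c)) (solve 2 (λ u v → v :- (v :- u) := u) refl (p x) (p c))
                              (+-monoˡ-< (p c) (neg-antimono-< pc-px<pc))

        root : p c ≡ 0#
        root with compare (p c) 0#
        ... | tri< pc<0 _ _ = ⊥-elim (p[c]≮0 pc<0)
        ... | tri≈ _ pc≡0 _ = pc≡0
        ... | tri> _ _ 0<pc = ⊥-elim (p[c]≯0 0<pc)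

    intermediate-value : Σ Carrier λ c → (a ≤ c × c ≤ b) × p c ≡ 0#
    intermediate-value with lub Below (a , ≤-refl , a≤b , pa<0) (b , λ _ below → proj₁ (proj₂ below))
    ... | c , upper , least = c , (a≤c , c≤b) , root
      where open Supremum c upper least

module LogarithmSeries (R : RealField) where

  open OrderedFieldProperties R
  open import Data.Nat as ℕ using (ℕ; zero; suc)
  import Data.Integer as ℤ
  open import Data.Empty using (⊥-elim)
  open import Data.Sum using (inj₁; inj₂)
  open import Relation.Binary.Definitions using (tri<; tri≈; tri>)
  open import Relation.Binary.PropositionalEquality

  logSum : ℕ → Carrier → Carrier
  logSum zero    r = 0#
  logSum (suc N) r = logSum N r + r ^ suc N * 1/[1+ N ]

  logPair : ℕ → Carrier → Carrier
  logPair m r = r ^ suc m * 1/[1+ m ] + r ^ suc (suc m) * 1/[1+ suc m ]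

  logSum-+2 : ∀ N r → logSum (suc (suc N)) r ≡ logSum N r + logPair N r
  logSum-+2 N r = +-assoc _ _ _

  logSum-pos : ∀ {r} N → 0# < r → 0# < logSum (suc N) r
  logSum-pos zero    0<r = +-nonneg-pos ≤-refl (*-pos (^-pos 1 0<r) (1/[1+n]-pos 0))
  logSum-pos (suc N) 0<r = +-pos-nonneg (logSum-pos N 0<r) (inj₁ (*-pos (^-pos (suc (suc N)) 0<r) (1/[1+n]-pos (suc N))))

  module _ {r} (-1≤r : - 1# ≤ r) (r<0 : r < 0#) where

    logPair-even-neg : ∀ k → logPair (k ℕ.* 2) r < 0#
    logPair-even-neg k = subst (_< 0#) (sym factor) (*-neg-pos (^-odd-neg k r<0) bracket-pos)
      where
      m : ℕ
      m = k ℕ.* 2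
      factor : logPair m r ≡ r ^ suc m * (1/[1+ m ] + r * 1/[1+ suc m ])
      factor = solve 4 (λ p r a b → p :* a :+ (r :* p) :* b := p :* (a :+ r :* b)) refl (r ^ suc m) r _ _
      bracket-pos : 0# < 1/[1+ m ] + r * 1/[1+ suc m ]
      bracket-pos = <-≤-trans (x<y⇒0<y-x (1/[1+n]-decreasing m))
        (+-monoˡ-≤ 1/[1+ m ] (subst (_≤ r * 1/[1+ suc m ]) (-1*x≈-x _) (*-monoʳ-≤ (inj₁ (1/[1+n]-pos (suc m))) -1≤r)))

    logSum-even-nonpos : ∀ k → logSum (k ℕ.* 2) r ≤ 0#
    logSum-even-neg : ∀ k → logSum (suc k ℕ.* 2) r < 0#

    logSum-even-nonpos zero    = ≤-refl
    logSum-even-nonpos (suc k) = inj₁ (logSum-even-neg k)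

    logSum-even-neg k = subst (_< 0#) (sym (logSum-+2 (k ℕ.* 2) r))
      (+-nonpos-neg (logSum-even-nonpos k) (logPair-even-neg k))

    logSum-odd-neg-≥-1 : ∀ k → logSum (suc (k ℕ.* 2)) r < 0#
    logSum-odd-neg-≥-1 k = +-nonpos-neg (logSum-even-nonpos k) (*-neg-pos (^-odd-neg k r<0) (1/[1+n]-pos (k ℕ.* 2)))

  -- h m = Σ_{i+j=m} sⁱ tʲ, with partial derivatives ∂ₛh m and ∂ₜh m.
  module CompleteHomogeneous (s t : Carrier) where

    h : ℕ → Carrier
    h zero    = 1#
    h (suc m) = s * h m + t ^ suc m

    ∂ₛh : ℕ → Carrier
    ∂ₛh zero    = 0#
    ∂ₛh (suc m) = h m + s * ∂ₛh m

    ∂ₜh : ℕ → Carrier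
    ∂ₜh zero    = 0#
    ∂ₜh (suc m) = s * ∂ₜh m + fromℕ (suc m) * t ^ m

    euler : ∀ m → s * ∂ₛh m + t * ∂ₜh m ≡ fromℕ m * h m
    euler zero    = solve 2 (λ s t → s :* :0 :+ t :* :0 := :0 :* :1) refl s t
    euler (suc m) = begin
      s * (h m + s * ∂ₛh m) + t * (s * ∂ₜh m + (1# + fromℕ m) * t ^ m)
        ≡⟨ solve 7 (λ s t H p q M T → s :* (H :+ s :* p) :+ t :* (s :* q :+ (:1 :+ M) :* T)
                   := s :* H :+ s :* (s :* p :+ t :* q) :+ (:1 :+ M) :* (t :* T))
                   refl s t (h m) (∂ₛh m) (∂ₜh m) (fromℕ m) (t ^ m) ⟩
      s * h m + s * (s * ∂ₛh m + t * ∂ₜh m) + (1# + fromℕ m) * (t * t ^ m)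
        ≡⟨ cong (λ u → s * h m + s * u + (1# + fromℕ m) * (t * t ^ m)) (euler m) ⟩
      s * h m + s * (fromℕ m * h m) + (1# + fromℕ m) * (t * t ^ m)
        ≡⟨ solve 4 (λ s H M T → s :* H :+ s :* (M :* H) :+ (:1 :+ M) :* T
                   := (:1 :+ M) :* (s :* H :+ T)) refl s (h m) (fromℕ m) (t * t ^ m) ⟩
      (1# + fromℕ m) * (s * h m + t * t ^ m) ∎
      where open ≡-Reasoning

    ∂ₛh+∂ₜh : ∀ m → ∂ₛh (suc m) + ∂ₜh (suc m) ≡ fromℕ (suc (suc m)) * h m
    ∂ₛh+∂ₜh zero = solve 1 (λ s → (:1 :+ s :* :0) :+ (s :* :0 :+ (:1 :+ :0) :* :1)
                              := (:1 :+ (:1 :+ :0)) :* :1) refl s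
    ∂ₛh+∂ₜh (suc m) = begin
      (h (suc m) + s * ∂ₛh (suc m)) + (s * ∂ₜh (suc m) + (1# + M) * t ^ suc m)
        ≡⟨ solve 6 (λ H s p q M T → (H :+ s :* p) :+ (s :* q :+ (:1 :+ M) :* T)
                   := H :+ s :* (p :+ q) :+ (:1 :+ M) :* T)
                   refl (h (suc m)) s (∂ₛh (suc m)) (∂ₜh (suc m)) M (t ^ suc m) ⟩
      h (suc m) + s * (∂ₛh (suc m) + ∂ₜh (suc m)) + (1# + M) * t ^ suc m
        ≡⟨ cong (λ u → h (suc m) + s * u + (1# + M) * t ^ suc m) (∂ₛh+∂ₜh m) ⟩
      (s * h m + t ^ suc m) + s * ((1# + M) * h m) + (1# + M) * t ^ suc m
        ≡⟨ solve 4 (λ s H T M → (s :* H :+ T) :+ s :* ((:1 :+ M) :* H) :+ (:1 :+ M) :* T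
                   := (:1 :+ (:1 :+ M)) :* (s :* H :+ T)) refl s (h m) (t ^ suc m) M ⟩
      (1# + (1# + M)) * (s * h m + t ^ suc m) ∎
      where
      open ≡-Reasoning
      M : Carrier
      M = fromℕ (suc m)

    [m+1]h[m+1]-[m+2]hm : ∀ m → fromℕ (suc m) * h (suc m) - fromℕ (suc (suc m)) * h m
                              ≡ (s - 1#) * ∂ₛh (suc m) + (t - 1#) * ∂ₜh (suc m)
    [m+1]h[m+1]-[m+2]hm m = begin
      fromℕ (suc m) * h (suc m) - fromℕ (suc (suc m)) * h m
        ≡⟨ cong₂ _-_ (euler (suc m)) (∂ₛh+∂ₜh m) ⟨
      (s * ∂ₛh (suc m) + t * ∂ₜh (suc m)) - (∂ₛh (suc m) + ∂ₜh (suc m))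
        ≡⟨ solve 4 (λ s t p q → (s :* p :+ t :* q) :- (p :+ q) := (s :- :1) :* p :+ (t :- :1) :* q)
                   refl s t (∂ₛh (suc m)) (∂ₜh (suc m)) ⟩
      (s - 1#) * ∂ₛh (suc m) + (t - 1#) * ∂ₜh (suc m) ∎
      where open ≡-Reasoning

    s^[m+1]-t^[m+1] : ∀ m → s ^ suc m - t ^ suc m ≡ (s - t) * h m
    s^[m+1]-t^[m+1] zero    = solve 2 (λ s t → s :* :1 :- t :* :1 := (s :- t) :* :1) refl s t
    s^[m+1]-t^[m+1] (suc m) = begin
      s * s ^ suc m - t * t ^ suc m
        ≡⟨ solve 4 (λ s t S T → s :* S :- t :* T := s :* (S :- T) :+ (s :- t) :* T) refl s t (s ^ suc m) (t ^ suc m) ⟩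
      s * (s ^ suc m - t ^ suc m) + (s - t) * t ^ suc m
        ≡⟨ cong (λ u → s * u + (s - t) * t ^ suc m) (s^[m+1]-t^[m+1] m) ⟩
      s * ((s - t) * h m) + (s - t) * t ^ suc m
        ≡⟨ solve 4 (λ s t H T → s :* ((s :- t) :* H) :+ (s :- t) :* T := (s :- t) :* (s :* H :+ T)) refl s t (h m) (t ^ suc m) ⟩
      (s - t) * (s * h m + t ^ suc m) ∎
      where open ≡-Reasoning

    module _ (0<s : 0# < s) (0<t : 0# < t) where

      h-pos : ∀ m → 0# < h m
      h-pos zero    = 0<1
      h-pos (suc m) = +-pos-nonneg (*-pos 0<s (h-pos m)) (^-nonneg (suc m) (inj₁ 0<t))

      ∂ₛh-nonneg : ∀ m → 0# ≤ ∂ₛh m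
      ∂ₛh-nonneg zero    = ≤-refl
      ∂ₛh-nonneg (suc m) = +-nonneg-nonneg (inj₁ (h-pos m)) (*-nonneg (inj₁ 0<s) (∂ₛh-nonneg m))

      ∂ₜh-nonneg : ∀ m → 0# ≤ ∂ₜh m
      ∂ₜh-nonneg zero    = ≤-refl
      ∂ₜh-nonneg (suc m) = +-nonneg-nonneg (*-nonneg (inj₁ 0<s) (∂ₜh-nonneg m))
                                           (*-nonneg (fromℕ-nonneg (suc m)) (^-nonneg m (inj₁ 0<t)))

      ∂ₛh-suc-pos : ∀ m → 0# < ∂ₛh (suc m)
      ∂ₛh-suc-pos m = +-pos-nonneg (h-pos m) (*-nonneg (inj₁ 0<s) (∂ₛh-nonneg m))

  W : ℕ → Carrier → Carrier
  W m s = s ^ suc (suc m) * 1/[1+ suc m ] - s ^ suc m * 1/[1+ m ]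

  W-difference : ∀ m s t → let open CompleteHomogeneous s t in
    W m s - W m t ≡ (s - t) * (1/[1+ suc m ] * 1/[1+ m ] * (fromℕ (suc m) * h (suc m) - fromℕ (suc (suc m)) * h m))
  W-difference m s t = begin
    W m s - W m t
      ≡⟨ solve 6 (λ S₂ S₁ T₂ T₁ a b → (S₂ :* b :- S₁ :* a) :- (T₂ :* b :- T₁ :* a) := (S₂ :- T₂) :* b :- (S₁ :- T₁) :* a)
                 refl (s ^ suc (suc m)) (s ^ suc m) (t ^ suc (suc m)) (t ^ suc m) a b ⟩
    (s ^ suc (suc m) - t ^ suc (suc m)) * b - (s ^ suc m - t ^ suc m) * a
      ≡⟨ cong₂ (λ u v → u * b - v * a) (s^[m+1]-t^[m+1] (suc m)) (s^[m+1]-t^[m+1] m) ⟩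
    (s - t) * h (suc m) * b - (s - t) * h m * a
      ≡⟨ solve 5 (λ d H₁ H₀ a b → d :* H₁ :* b :- d :* H₀ :* a := d :* (H₁ :* b :- H₀ :* a)) refl (s - t) (h (suc m)) (h m) a b ⟩
    (s - t) * (h (suc m) * b - h m * a)
      ≡⟨ cong ((s - t) *_) clear-denominators ⟨
    (s - t) * (b * a * (A * h (suc m) - B * h m)) ∎
    where
    open ≡-Reasoning
    open CompleteHomogeneous s t
    a b A B : Carrier
    a = 1/[1+ m ]
    b = 1/[1+ suc m ]
    A = fromℕ (suc m)
    B = fromℕ (suc (suc m))
    clear-denominators : b * a * (A * h (suc m) - B * h m) ≡ h (suc m) * b - h m * a
    clear-denominators = begin
      b * a * (A * h (suc m) - B * h m)
        ≡⟨ solve 6 (λ b a A B H₁ H₀ → b :* a :* (A :* H₁ :- B :* H₀) := H₁ :* b :* (A :* a) :- H₀ :* a :* (B :* b))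
                   refl b a A B (h (suc m)) (h m) ⟩
      h (suc m) * b * (A * a) - h m * a * (B * b)
        ≡⟨ cong₂ (λ u v → h (suc m) * b * u - h m * a * v) ([1+n]*1/[1+n]≡1 m) ([1+n]*1/[1+n]≡1 (suc m)) ⟩
      h (suc m) * b * 1# - h m * a * 1#
        ≡⟨ cong₂ _-_ (*-identityʳ _) (*-identityʳ _) ⟩
      h (suc m) * b - h m * a ∎

  W-strictMono : ∀ m {s t} → 1# ≤ t → t < s → W m t < W m s
  W-strictMono m {s} {t} 1≤t t<s = 0<y-x⇒x<y (subst (0# <_) (sym (W-difference m s t))
    (*-pos (x<y⇒0<y-x t<s) (*-pos (*-pos (1/[1+n]-pos (suc m)) (1/[1+n]-pos m)) gap-pos)))
    where
    open CompleteHomogeneous s t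
    0<t : 0# < t
    0<t = <-≤-trans 0<1 1≤t
    1<s : 1# < s
    1<s = ≤-<-trans 1≤t t<s
    gap-pos : 0# < fromℕ (suc m) * h (suc m) - fromℕ (suc (suc m)) * h m
    gap-pos = subst (0# <_) (sym ([m+1]h[m+1]-[m+2]hm m))
      (+-pos-nonneg (*-pos (x<y⇒0<y-x 1<s) (∂ₛh-suc-pos (<-trans 0<1 1<s) 0<t m))
                    (*-nonneg (x≤y⇒0≤y-x 1≤t) (∂ₜh-nonneg (<-trans 0<1 1<s) 0<t (suc m))))

  logPair-even-at-neg : ∀ k s → logPair (k ℕ.* 2) (- s) ≡ W (k ℕ.* 2) s
  logPair-even-at-neg k s = begin
    (- s) ^ suc m * a + (- s) ^ (suc k ℕ.* 2) * b
      ≡⟨ cong₂ (λ u v → u * a + v * b) (-x^odd≡-x^odd s k) (-x^even≡x^even s (suc k)) ⟩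
    - (s ^ suc m) * a + s ^ (suc k ℕ.* 2) * b
      ≡⟨ solve 4 (λ S₁ a S₂ b → :- S₁ :* a :+ S₂ :* b := S₂ :* b :- S₁ :* a)
                 refl (s ^ suc m) a (s ^ (suc k ℕ.* 2)) b ⟩
    W m s ∎
    where
    open ≡-Reasoning
    m : ℕ
    a b : Carrier
    m = k ℕ.* 2
    a = 1/[1+ m ]
    b = 1/[1+ suc m ]

  logPair-odd-at-neg : ∀ k s → logPair (suc (k ℕ.* 2)) (- s) ≡ - W (suc (k ℕ.* 2)) s
  logPair-odd-at-neg k s = begin
    (- s) ^ (suc k ℕ.* 2) * a + (- s) ^ suc (suc k ℕ.* 2) * b
      ≡⟨ cong₂ (λ u v → u * a + v * b) (-x^even≡x^even s (suc k)) (-x^odd≡-x^odd s (suc k)) ⟩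
    s ^ (suc k ℕ.* 2) * a + - (s ^ suc (suc k ℕ.* 2)) * b
      ≡⟨ solve 4 (λ S₁ a S₂ b → S₁ :* a :+ :- S₂ :* b := :- (S₂ :* b :- S₁ :* a))
                 refl (s ^ (suc k ℕ.* 2)) a (s ^ suc (suc k ℕ.* 2)) b ⟩
    - W m s ∎
    where
    open ≡-Reasoning
    m : ℕ
    a b : Carrier
    m = suc (k ℕ.* 2)
    a = 1/[1+ m ]
    b = 1/[1+ suc m ]

  module _ {r t} (r<t : r < t) (t≤-1 : t ≤ - 1#) where

    private
      W[-t]<W[-r] : ∀ m → W m (- t) < W m (- r)
      W[-t]<W[-r] m = W-strictMono m (subst (_≤ - t) (-‿involutive 1#) (neg-antimono-≤ t≤-1)) (neg-antimono-< r<t)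

      at-neg-neg : ∀ m x → logPair m x ≡ logPair m (- (- x))
      at-neg-neg m x = cong (logPair m) (sym (-‿involutive x))

    logPair-even-strictAnti : ∀ k → logPair (k ℕ.* 2) t < logPair (k ℕ.* 2) r
    logPair-even-strictAnti k = subst₂ _<_
      (sym (trans (at-neg-neg (k ℕ.* 2) t) (logPair-even-at-neg k (- t))))
      (sym (trans (at-neg-neg (k ℕ.* 2) r) (logPair-even-at-neg k (- r))))
      (W[-t]<W[-r] (k ℕ.* 2))

    logPair-odd-strictMono : ∀ k → logPair (suc (k ℕ.* 2)) r < logPair (suc (k ℕ.* 2)) t
    logPair-odd-strictMono k = subst₂ _<_
      (sym (trans (at-neg-neg (suc (k ℕ.* 2)) r) (logPair-odd-at-neg k (- r))))
      (sym (trans (at-neg-neg (suc (k ℕ.* 2)) t) (logPair-odd-at-neg k (- t))))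
      (neg-antimono-< (W[-t]<W[-r] (suc (k ℕ.* 2))))

    logSum-odd-strictMono : ∀ k → logSum (suc (k ℕ.* 2)) r < logSum (suc (k ℕ.* 2)) t
    logSum-odd-strictMono zero    = +-monoˡ-< 0# (*-monoʳ-< (1/[1+n]-pos 0) (*-monoʳ-< 0<1 r<t))
    logSum-odd-strictMono (suc k) = subst₂ _<_ (sym (logSum-+2 (suc (k ℕ.* 2)) r)) (sym (logSum-+2 (suc (k ℕ.* 2)) t))
      (+-mono-<-≤ (logSum-odd-strictMono k) (inj₁ (logPair-odd-strictMono k)))

    logSum-even-strictAnti : ∀ k → logSum (suc k ℕ.* 2) t < logSum (suc k ℕ.* 2) r
    logSum-even-strictAnti k = subst₂ _<_ (sym (logSum-+2 (k ℕ.* 2) t)) (sym (logSum-+2 (k ℕ.* 2) r))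
      (+-mono-≤-< (previous k) (logPair-even-strictAnti k))
      where
      previous : ∀ k → logSum (k ℕ.* 2) t ≤ logSum (k ℕ.* 2) r
      previous zero    = ≤-refl
      previous (suc k) = inj₁ (logSum-even-strictAnti k)

  logSum-odd-neg : ∀ k {r} → r < 0# → logSum (suc (k ℕ.* 2)) r < 0#
  logSum-odd-neg k {r} r<0 with ≤-<-cases (- 1#) r
  ... | inj₁ -1≤r = logSum-odd-neg-≥-1 -1≤r r<0 k
  ... | inj₂ r<-1 = <-trans (logSum-odd-strictMono r<-1 ≤-refl k)
                            (logSum-odd-neg-≥-1 ≤-refl (0<x⇒-x<0 0<1) k)

  logSum-even-injective : ∀ k {r t} → r ≤ - 1# → t ≤ - 1# →
    logSum (suc k ℕ.* 2) r ≡ logSum (suc k ℕ.* 2) t → r ≡ t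
  logSum-even-injective k {r} {t} r≤-1 t≤-1 eq with compare r t
  ... | tri< r<t _ _ = ⊥-elim (>⇒≢ (logSum-even-strictAnti r<t t≤-1 k) eq)
  ... | tri≈ _ r≡t _ = r≡t
  ... | tri> _ _ t<r = ⊥-elim (<⇒≢ (logSum-even-strictAnti t<r r≤-1 k) eq)

module PolynomialC (R : RealField) where

  open OrderedFieldProperties R
  open RationalEmbedding R
  open LogarithmSeries R using (logSum)
  open IntermediateValue R using (lipschitzConstant; eval-lipschitz)
  open Binomial using ([n+1-k]*[n+1]Ck≡[n+1]*nCk)
  open import Function.Base using (_∘_)
  open import Data.Nat as ℕ using (ℕ; zero; suc; _∸_; z<s; s<s)
  import Data.Nat.Properties as ℕ
  open import Data.Nat.Combinatorics using (nC1≡n; nCn≡1; nCk+nC[k+1]≡[n+1]C[k+1]) renaming (_C_ to _choose_)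
  import Data.Integer as ℤ
  open import Data.Rational as ℚ using (ℚ)
  open import Data.List using (List; map; applyUpTo)
  import Data.List.Properties as List
  open import Data.Product using (_,_)
  open import Relation.Binary.PropositionalEquality
  open import Relation.Nullary using (¬_)

  harmonic : ℕ → Carrier
  harmonic zero    = 0#
  harmonic (suc m) = harmonic m + 1/[1+ m ]

  fromℚ-H : ∀ m → fromℚ (H m) ≡ harmonic m
  fromℚ-H zero    = zeroˡ _
  fromℚ-H (suc m) = begin
    fromℚ (H m ℚ.+ ℤ.+ 1 ℚ./ suc m)        ≡⟨ fromℚ-+ (H m) _ ⟩
    fromℚ (H m) + fromℚ (ℤ.+ 1 ℚ./ suc m)  ≡⟨ cong₂ _+_ (fromℚ-H m) (fromℚ-/ (ℤ.+ 1) m) ⟩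
    harmonic m + (1# + 0#) * 1/[1+ m ]     ≡⟨ cong (λ u → harmonic m + u * 1/[1+ m ]) (+-identityʳ 1#) ⟩
    harmonic m + 1# * 1/[1+ m ]            ≡⟨ cong (harmonic m +_) (*-identityˡ _) ⟩
    harmonic m + 1/[1+ m ]                 ∎
    where open ≡-Reasoning

  coeff : ℕ → ℕ → Carrier
  coeff d k = fromℕ (suc d choose suc k) * (harmonic (suc d) - harmonic (d ∸ k))

  fromℚ-Ccoeff : ∀ d k → fromℚ (Ccoeff (suc (suc d)) k) ≡ coeff d k
  fromℚ-Ccoeff d k = begin
    fromℚ (Ccoeff (suc (suc d)) k)
      ≡⟨ fromℚ-* (ℤ.+ (suc d choose suc k) ℚ./ 1) _ ⟩
    fromℚ (ℤ.+ (suc d choose suc k) ℚ./ 1) * fromℚ (H (suc d) ℚ.- H (suc (suc d) ∸ (k ℕ.+ 2)))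
      ≡⟨ cong₂ _*_ (fromℚ-/ (ℤ.+ (suc d choose suc k)) 0)
                   (trans (fromℚ-+ (H (suc d)) _) (cong (fromℚ (H (suc d)) +_) (fromℚ-neg (H (suc (suc d) ∸ (k ℕ.+ 2)))))) ⟩
    fromℕ (suc d choose suc k) * 1/[1+ 0 ] * (fromℚ (H (suc d)) - fromℚ (H (suc (suc d) ∸ (k ℕ.+ 2))))
      ≡⟨ cong₂ (λ u v → fromℕ (suc d choose suc k) * u * (fromℚ (H (suc d)) - fromℚ (H v))) 1/[1+0]≡1 index ⟩
    fromℕ (suc d choose suc k) * 1# * (fromℚ (H (suc d)) - fromℚ (H (d ∸ k)))
      ≡⟨ cong₂ (λ u v → u * (v - fromℚ (H (d ∸ k)))) (*-identityʳ _) (fromℚ-H (suc d)) ⟩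
    fromℕ (suc d choose suc k) * (harmonic (suc d) - fromℚ (H (d ∸ k)))
      ≡⟨ cong (λ u → fromℕ (suc d choose suc k) * (harmonic (suc d) - u)) (fromℚ-H (d ∸ k)) ⟩
    coeff d k ∎
    where
    open ≡-Reasoning
    index : suc (suc d) ∸ (k ℕ.+ 2) ≡ d ∸ k
    index = cong (suc (suc d) ∸_) (ℕ.+-comm k 2)

  horner : (ℕ → Carrier) → ℕ → Carrier → Carrier
  horner a zero    x = 0#
  horner a (suc n) x = a 0 + x * horner (a ∘ suc) n x

  eval-applyUpTo : ∀ (q : ℕ → ℚ) n x → eval (applyUpTo q n) x ≡ horner (fromℚ ∘ q) n x
  eval-applyUpTo q zero    x = refl
  eval-applyUpTo q (suc n) x = cong (λ u → fromℚ (q 0) + x * u) (eval-applyUpTo (q ∘ suc) n x)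

  horner-cong : ∀ {a b} n x → (∀ k → k ℕ.< n → a k ≡ b k) → horner a n x ≡ horner b n x
  horner-cong zero    x _  = refl
  horner-cong (suc n) x eq = cong₂ (λ u v → u + x * v) (eq 0 z<s) (horner-cong n x (λ k k<n → eq (suc k) (s<s k<n)))

  horner-+ : ∀ a b n x → horner (λ k → a k + b k) n x ≡ horner a n x + horner b n x
  horner-+ a b zero    x = sym (+-identityʳ 0#)
  horner-+ a b (suc n) x = trans (cong (λ u → a 0 + b 0 + x * u) (horner-+ (a ∘ suc) (b ∘ suc) n x))
    (solve 5 (λ a b x u v → a :+ b :+ x :* (u :+ v) := (a :+ x :* u) :+ (b :+ x :* v)) refl (a 0) (b 0) x _ _)

  horner-last : ∀ a n x → horner a (suc n) x ≡ horner a n x + a n * x ^ n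
  horner-last a zero    x = solve 2 (λ a x → a :+ x :* :0 := :0 :+ a :* :1) refl (a 0) x
  horner-last a (suc n) x = trans (cong (λ u → a 0 + x * u) (horner-last (a ∘ suc) n x))
    (solve 5 (λ a₀ x h aₙ p → a₀ :+ x :* (h :+ aₙ :* p) := (a₀ :+ x :* h) :+ aₙ :* (x :* p)) refl (a 0) x _ (a (suc n)) (x ^ n))

  shift : (ℕ → Carrier) → ℕ → Carrier
  shift a zero    = 0#
  shift a (suc k) = a k

  horner-shift : ∀ a n x → horner (shift a) (suc n) x ≡ x * horner a n x
  horner-shift a n x = +-identityˡ _

  -- S d is C (d + 2) as a function (eval-C≡S); indexing by the degree d = n - 2
  -- makes all recursions start at 0.
  S : ℕ → Carrier → Carrier
  S zero    x = 1#
  S (suc d) x = (1# + x) * S d x + x ^ suc d * 1/[1+ suc d ]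

  [1+m]*[H[1+m]-Hm]≡1 : ∀ m → fromℕ (suc m) * (harmonic (suc m) - harmonic m) ≡ 1#
  [1+m]*[H[1+m]-Hm]≡1 m = trans (solve 3 (λ A h r → A :* (h :+ r :- h) := A :* r) refl (fromℕ (suc m)) (harmonic m) 1/[1+ m ])
                                ([1+n]*1/[1+n]≡1 m)

  coeff-zero : ∀ d → coeff d 0 ≡ 1#
  coeff-zero d = trans (cong (λ u → fromℕ u * (harmonic (suc d) - harmonic d)) (nC1≡n (suc d))) ([1+m]*[H[1+m]-Hm]≡1 d)

  coeff-top : ∀ d → coeff (suc d) (suc d) ≡ coeff d d + 1/[1+ suc d ]
  coeff-top d = begin
    fromℕ (suc (suc d) choose suc (suc d)) * (harmonic (suc d) + 1/[1+ suc d ] - harmonic (d ∸ d))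
      ≡⟨ cong₂ (λ u v → fromℕ u * (harmonic (suc d) + 1/[1+ suc d ] - harmonic v)) (nCn≡1 (suc (suc d))) (ℕ.n∸n≡0 d) ⟩
    (1# + 0#) * (harmonic (suc d) + 1/[1+ suc d ] - 0#)
      ≡⟨ solve 2 (λ h r → (:1 :+ :0) :* (h :+ r :- :0)
                        := (:1 :+ :0) :* (h :- :0) :+ r) refl (harmonic (suc d)) 1/[1+ suc d ] ⟩
    (1# + 0#) * (harmonic (suc d) - 0#) + 1/[1+ suc d ]
      ≡⟨ cong₂ (λ u v → fromℕ u * (harmonic (suc d) - harmonic v) + 1/[1+ suc d ]) (nCn≡1 (suc d)) (ℕ.n∸n≡0 d) ⟨
    coeff d d + 1/[1+ suc d ] ∎
    where open ≡-Reasoning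

  -- Pascal's rule; the harmonic factors match up because
  -- (a + 1) · C(k + a + 1, k) = (k + a + 1) · C(k + a, k) for k = j + 2.
  coeff-pascal : ∀ j a → coeff (suc (suc (j ℕ.+ a))) (suc j) ≡ coeff (suc (j ℕ.+ a)) (suc j) + coeff (suc (j ℕ.+ a)) j
  coeff-pascal j a = begin
    fromℕ (suc (suc d) choose suc (suc j)) * (Hₙ + rₙ - harmonic (d ∸ j))
      ≡⟨ cong₂ (λ u v → u * (Hₙ + rₙ - harmonic v)) (trans (cong fromℕ (sym pascal)) (fromℕ-+ b₁ b₂)) d∸j≡1+a ⟩
    (X₁ + X₂) * (Hₙ + rₙ - (Hₐ + rₐ))
      ≡⟨ solve 6 (λ X₁ X₂ Hₙ rₙ Hₐ rₐ → (X₁ :+ X₂) :* (Hₙ :+ rₙ :- (Hₐ :+ rₐ))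
                  := X₂ :* (Hₙ :- Hₐ) :+ X₁ :* (Hₙ :- (Hₐ :+ rₐ)) :+ ((X₁ :+ X₂) :* rₙ :- X₂ :* rₐ)) refl X₁ X₂ Hₙ rₙ Hₐ rₐ ⟩
    X₂ * (Hₙ - Hₐ) + X₁ * (Hₙ - (Hₐ + rₐ)) + ((X₁ + X₂) * rₙ - X₂ * rₐ)
      ≡⟨ cong (λ u → X₂ * (Hₙ - Hₐ) + X₁ * (Hₙ - (Hₐ + rₐ)) + (u - X₂ * rₐ)) denominators ⟩
    X₂ * (Hₙ - Hₐ) + X₁ * (Hₙ - (Hₐ + rₐ)) + (X₂ * rₐ - X₂ * rₐ)
      ≡⟨ trans (cong (X₂ * (Hₙ - Hₐ) + X₁ * (Hₙ - (Hₐ + rₐ)) +_) (-‿inverseʳ (X₂ * rₐ))) (+-identityʳ _) ⟩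
    X₂ * (Hₙ - Hₐ) + X₁ * (Hₙ - (Hₐ + rₐ))
      ≡⟨ cong₂ (λ u v → X₂ * (Hₙ - harmonic u) + X₁ * (Hₙ - harmonic v)) (ℕ.m+n∸m≡n j a) d∸j≡1+a ⟨
    coeff d (suc j) + coeff d j ∎
    where
    open ≡-Reasoning
    d : ℕ
    d = suc (j ℕ.+ a)
    b₁ b₂ : ℕ
    X₁ X₂ Hₙ rₙ Hₐ rₐ : Carrier
    b₁ = suc d choose suc j
    b₂ = suc d choose suc (suc j)
    X₁ = fromℕ b₁
    X₂ = fromℕ b₂
    Hₙ = harmonic (suc d)
    rₙ = 1/[1+ suc d ]
    Hₐ = harmonic a
    rₐ = 1/[1+ a ]
    pascal : b₁ ℕ.+ b₂ ≡ suc (suc d) choose suc (suc j)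
    pascal = nCk+nC[k+1]≡[n+1]C[k+1] (suc d) (suc j)
    d∸j≡1+a : d ∸ j ≡ suc a
    d∸j≡1+a = trans (cong (_∸ j) (sym (ℕ.+-suc j a))) (ℕ.m+n∸m≡n j (suc a))
    denominators : (X₁ + X₂) * rₙ ≡ X₂ * rₐ
    denominators = cross-multiply (fromℕ-suc≢0 (suc d)) (fromℕ-suc≢0 a) (begin
      (X₁ + X₂) * fromℕ (suc a)          ≡⟨ cong (_* fromℕ (suc a)) (fromℕ-+ b₁ b₂) ⟨
      fromℕ (b₁ ℕ.+ b₂) * fromℕ (suc a)  ≡⟨ fromℕ-* (b₁ ℕ.+ b₂) (suc a) ⟨
      fromℕ ((b₁ ℕ.+ b₂) ℕ.* suc a)      ≡⟨ cong fromℕ (ℕ.*-comm (b₁ ℕ.+ b₂) (suc a)) ⟩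
      fromℕ (suc a ℕ.* (b₁ ℕ.+ b₂))      ≡⟨ cong (λ b → fromℕ (suc a ℕ.* b)) pascal ⟩
      fromℕ (suc a ℕ.* (suc (suc d) choose suc (suc j))) ≡⟨ cong fromℕ ([n+1-k]*[n+1]Ck≡[n+1]*nCk (suc (suc j)) a) ⟩
      fromℕ (suc (suc d) ℕ.* b₂)         ≡⟨ trans (fromℕ-* (suc (suc d)) b₂) (*-comm _ _) ⟩
      X₂ * fromℕ (suc (suc d))           ∎)

  coeff-suc : ∀ d k → k ℕ.< suc d → coeff (suc d) k ≡ coeff d k + shift (coeff d) k
  coeff-suc d zero    _         = trans (coeff-zero (suc d)) (sym (trans (+-identityʳ _) (coeff-zero d)))
  coeff-suc d (suc j) (s<s j<d) with ℕ.m≤n⇒∃[o]m+o≡n j<d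
  ... | a , refl = coeff-pascal j a

  horner-coeff≡S : ∀ d x → horner (coeff d) (suc d) x ≡ S d x
  horner-coeff≡S zero    x = begin
    coeff 0 0 + x * 0#  ≡⟨ cong₂ _+_ (coeff-zero 0) (zeroʳ x) ⟩
    1# + 0#             ≡⟨ +-identityʳ 1# ⟩
    1#                  ∎
    where open ≡-Reasoning
  horner-coeff≡S (suc d) x = begin
    horner (coeff (suc d)) (suc (suc d)) x
      ≡⟨ horner-last (coeff (suc d)) (suc d) x ⟩
    horner (coeff (suc d)) (suc d) x + coeff (suc d) (suc d) * x ^ suc d
      ≡⟨ cong₂ (λ u v → u + v * x ^ suc d) (horner-cong (suc d) x (coeff-suc d)) (coeff-top d) ⟩
    horner (λ k → coeff d k + shift (coeff d) k) (suc d) x + (coeff d d + r) * x ^ suc d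
      ≡⟨ cong (λ u → u + (coeff d d + r) * x ^ suc d) (horner-+ (coeff d) (shift (coeff d)) (suc d) x) ⟩
    (h + horner (shift (coeff d)) (suc d) x) + (coeff d d + r) * x ^ suc d
      ≡⟨ solve 5 (λ h g c r p → (h :+ g) :+ (c :+ r) :* p := h :+ (g :+ c :* p) :+ p :* r)
                 refl h (horner (shift (coeff d)) (suc d) x) (coeff d d) r (x ^ suc d) ⟩
    h + (horner (shift (coeff d)) (suc d) x + shift (coeff d) (suc d) * x ^ suc d) + x ^ suc d * r
      ≡⟨ cong (λ u → h + u + x ^ suc d * r) (sym (horner-last (shift (coeff d)) (suc d) x)) ⟩
    h + horner (shift (coeff d)) (suc (suc d)) x + x ^ suc d * r
      ≡⟨ cong (λ u → h + u + x ^ suc d * r) (horner-shift (coeff d) (suc d) x) ⟩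
    h + x * h + x ^ suc d * r
      ≡⟨ cong (λ u → u + x * u + x ^ suc d * r) (horner-coeff≡S d x) ⟩
    S d x + x * S d x + x ^ suc d * r
      ≡⟨ solve 3 (λ s x t → s :+ x :* s :+ t := (:1 :+ x) :* s :+ t) refl (S d x) x (x ^ suc d * r) ⟩
    S (suc d) x ∎
    where
    open ≡-Reasoning
    h r : Carrier
    h = horner (coeff d) (suc d) x
    r = 1/[1+ suc d ]

  eval-C≡S : ∀ d x → eval (C (suc (suc d))) x ≡ S d x
  eval-C≡S d x = begin
    eval (map (Ccoeff (suc (suc d))) (applyUpTo (λ k → k) (suc d))) x
      ≡⟨ cong (λ l → eval l x) (List.map-applyUpTo (λ k → k) (Ccoeff (suc (suc d))) (suc d)) ⟩
    eval (applyUpTo (Ccoeff (suc (suc d))) (suc d)) x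
      ≡⟨ eval-applyUpTo (Ccoeff (suc (suc d))) (suc d) x ⟩
    horner (fromℚ ∘ Ccoeff (suc (suc d))) (suc d) x
      ≡⟨ horner-cong (suc d) x (λ k _ → fromℚ-Ccoeff d k) ⟩
    horner (coeff d) (suc d) x
      ≡⟨ horner-coeff≡S d x ⟩
    S d x ∎
    where open ≡-Reasoning

  S-lipschitz : ∀ d {y z} → ∣ y ∣ ≤ 1# → ∣ z ∣ ≤ 1# →
    ∣ S d y - S d z ∣ ≤ lipschitzConstant (C (suc (suc d))) * ∣ y - z ∣
  S-lipschitz d {y} {z} ∣y∣≤1 ∣z∣≤1 = subst (λ u → ∣ u ∣ ≤ lipschitzConstant (C (suc (suc d))) * ∣ y - z ∣)
    (cong₂ _-_ (eval-C≡S d y) (eval-C≡S d z)) (eval-lipschitz (C (suc (suc d))) ∣y∣≤1 ∣z∣≤1)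

  S-at-0 : ∀ d → S d 0# ≡ 1#
  S-at-0 zero    = refl
  S-at-0 (suc d) = begin
    (1# + 0#) * S d 0# + 0# ^ suc d * 1/[1+ suc d ]
      ≡⟨ cong₂ (λ u v → (1# + 0#) * u + v * 1/[1+ suc d ]) (S-at-0 d) (zeroˡ _) ⟩
    (1# + 0#) * 1# + 0# * 1/[1+ suc d ]              ≡⟨ solve 1 (λ r → (:1 :+ :0) :* :1 :+ :0 :* r := :1) refl _ ⟩
    1#                                               ∎
    where open ≡-Reasoning

  S-at-−1 : ∀ d → S d (- 1#) ≡ (- 1#) ^ d * 1/[1+ d ]
  S-at-−1 zero    = sym (trans (*-identityˡ _) 1/[1+0]≡1)
  S-at-−1 (suc d) = begin
    (1# - 1#) * S d (- 1#) + t  ≡⟨ cong (λ u → u * S d (- 1#) + t) (-‿inverseʳ 1#) ⟩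
    0# * S d (- 1#) + t         ≡⟨ cong (_+ t) (zeroˡ (S d (- 1#))) ⟩
    0# + t                      ≡⟨ +-identityˡ t ⟩
    t                           ∎
    where
    open ≡-Reasoning
    t : Carrier
    t = (- 1#) ^ suc d * 1/[1+ suc d ]

  ratio : Carrier → Carrier
  ratio x = x * (1# + x) ⁻¹

  [1+x]*ratio≡x : ∀ {x} → ¬ (1# + x ≡ 0#) → (1# + x) * ratio x ≡ x
  [1+x]*ratio≡x {x} = x*[y*x⁻¹]≡y x

  x*S≡[1+x]^[d+1]*logSum : ∀ d {x} → ¬ (1# + x ≡ 0#) →
    x * S d x ≡ (1# + x) ^ suc d * logSum (suc d) (ratio x)
  x*S≡[1+x]^[d+1]*logSum d {x} 1+x≢0 = go d
    where
    b r : Carrier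
    b = 1# + x
    r = ratio x
    b*r≡x : b * r ≡ x
    b*r≡x = [1+x]*ratio≡x 1+x≢0
    go : ∀ d → x * S d x ≡ b ^ suc d * logSum (suc d) r
    go zero = begin
      x * 1#                              ≡⟨ *-identityʳ x ⟩
      x                                   ≡⟨ b*r≡x ⟨
      b * r                               ≡⟨ solve 2 (λ b r → b :* r := b :* :1 :* (:0 :+ r :* :1 :* :1)) refl b r ⟩
      b * 1# * (0# + r * 1# * 1#)         ≡⟨ cong (λ u → b * 1# * (0# + r * 1# * u)) 1/[1+0]≡1 ⟨
      b * 1# * (0# + r * 1# * 1/[1+ 0 ])  ∎
      where open ≡-Reasoning
    go (suc d) = begin
      x * (b * S d x + x ^ suc d * c)
        ≡⟨ solve 5 (λ x b s p c → x :* (b :* s :+ p :* c) := b :* (x :* s) :+ (x :* p) :* c) refl x b (S d x) (x ^ suc d) c ⟩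
      b * (x * S d x) + x ^ suc (suc d) * c
        ≡⟨ cong₂ (λ u v → b * u + v ^ suc (suc d) * c) (go d) (sym b*r≡x) ⟩
      b * (b ^ suc d * logSum (suc d) r) + (b * r) ^ suc (suc d) * c
        ≡⟨ cong (λ u → b * (b ^ suc d * logSum (suc d) r) + u * c) (^-distribʳ-* b r (suc (suc d))) ⟩
      b * (b ^ suc d * logSum (suc d) r) + b ^ suc (suc d) * r ^ suc (suc d) * c
        ≡⟨ solve 5 (λ b B L R c → b :* (B :* L) :+ (b :* B) :* R :* c := (b :* B) :* (L :+ R :* c))
                   refl b (b ^ suc d) (logSum (suc d) r) (r ^ suc (suc d)) c ⟩
      b ^ suc (suc d) * (logSum (suc d) r + r ^ suc (suc d) * c) ∎
      where
      open ≡-Reasoning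
      c : Carrier
      c = 1/[1+ suc d ]

module RootsOfS (R : RealField) where

  open OrderedFieldProperties R
  open LogarithmSeries R
  open PolynomialC R
  open IntermediateValue R
  open import Data.Nat as ℕ using (ℕ; suc)
  open import Data.Product using (Σ; _×_; _,_; proj₂; map₂)
  open import Data.Sum using (inj₁; inj₂)
  open import Data.Empty using (⊥-elim)
  open import Relation.Binary.PropositionalEquality
  open import Relation.Binary.Definitions using (tri<; tri≈; tri>)
  open import Relation.Nullary using (¬_)
  import Data.Integer as ℤ

  x*[1-ratio]≡ratio : ∀ {x} → ¬ (1# + x ≡ 0#) → x * (1# - ratio x) ≡ ratio x
  x*[1-ratio]≡ratio {x} 1+x≢0 = begin
    x * (1# - r)            ≡⟨ solve 2 (λ x r → x :* (:1 :- r) := r :+ (x :- (:1 :+ x) :* r)) refl x r ⟩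
    r + (x - (1# + x) * r)  ≡⟨ cong (λ u → r + (x - u)) ([1+x]*ratio≡x 1+x≢0) ⟩
    r + (x - x)             ≡⟨ solve 2 (λ x r → r :+ (x :- x) := r) refl x r ⟩
    r                       ∎
    where
    r : Carrier
    r = ratio x
    open ≡-Reasoning

  ratio≢1 : ∀ {x} → ¬ (1# + x ≡ 0#) → ¬ (ratio x ≡ 1#)
  ratio≢1 {x} 1+x≢0 r≡1 = 0≢1 (sym (begin
    1#          ≡⟨ solve 1 (λ x → :1 := :1 :+ x :- x) refl x ⟩
    1# + x - x  ≡⟨ cong (_- x) 1+x≡x ⟩
    x - x       ≡⟨ -‿inverseʳ x ⟩
    0#          ∎))
    where
    open ≡-Reasoning
    1+x≡x : 1# + x ≡ x
    1+x≡x = trans (sym (*-identityʳ _)) (trans (cong ((1# + x) *_) (sym r≡1)) ([1+x]*ratio≡x 1+x≢0))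

  ratio-injective : ∀ {x y} → ¬ (1# + x ≡ 0#) → ¬ (1# + y ≡ 0#) → ratio x ≡ ratio y → x ≡ y
  ratio-injective {x} {y} 1+x≢0 1+y≢0 rx≡ry = *-cancelʳ 1-r≢0 (begin
    x * (1# - ratio y)  ≡⟨ cong (λ u → x * (1# - u)) rx≡ry ⟨
    x * (1# - ratio x)  ≡⟨ x*[1-ratio]≡ratio 1+x≢0 ⟩
    ratio x             ≡⟨ rx≡ry ⟩
    ratio y             ≡⟨ x*[1-ratio]≡ratio 1+y≢0 ⟨
    y * (1# - ratio y)  ∎)
    where
    open ≡-Reasoning
    1-r≢0 : ¬ (1# - ratio y ≡ 0#)
    1-r≢0 1-r≡0 = ratio≢1 1+y≢0 (sym (x-y≡0⇒x≡y 1-r≡0))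

  module _ d {x} (Sx≡0 : S d x ≡ 0#) where

    private
      -1≢0 : ¬ (- 1# ≡ 0#)
      -1≢0 = <⇒≢ (0<x⇒-x<0 0<1)

    root-1+x≢0 : ¬ (1# + x ≡ 0#)
    root-1+x≢0 1+x≡0 = >⇒≢ (1/[1+n]-pos d)
      (x*y≡0⇒y≡0 (^-nonzero d -1≢0) (trans (sym (S-at-−1 d)) (subst (λ y → S d y ≡ 0#) x≡-1 Sx≡0)))
      where
      x≡-1 : x ≡ - 1#
      x≡-1 = begin
        x            ≡⟨ solve 1 (λ x → x := (:1 :+ x) :- :1) refl x ⟩
        1# + x - 1#  ≡⟨ cong (_- 1#) 1+x≡0 ⟩
        0# - 1#      ≡⟨ +-identityˡ _ ⟩
        - 1#         ∎
        where open ≡-Reasoning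

    root-x≢0 : ¬ (x ≡ 0#)
    root-x≢0 refl = 0≢1 (trans (sym Sx≡0) (S-at-0 d))

    logSum-at-ratio-root : logSum (suc d) (ratio x) ≡ 0#
    logSum-at-ratio-root = x*y≡0⇒y≡0 (^-nonzero (suc d) root-1+x≢0)
      (trans (sym (x*S≡[1+x]^[d+1]*logSum d root-1+x≢0)) (trans (cong (x *_) Sx≡0) (zeroʳ x)))

    ratio-root-neg : ratio x < 0#
    ratio-root-neg with compare (ratio x) 0#
    ... | tri< r<0 _ _ = r<0
    ... | tri≈ _ r≡0 _ = ⊥-elim (root-x≢0
      (trans (sym ([1+x]*ratio≡x root-1+x≢0)) (trans (cong ((1# + x) *_) r≡0) (zeroʳ _))))
    ... | tri> _ _ 0<r = ⊥-elim (>⇒≢ (logSum-pos d 0<r) logSum-at-ratio-root)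

    root-location : - 1# < x × x < 0#
    root-location with compare (1# + x) 0#
    ... | tri< 1+x<0 _ _ = ⊥-elim (<-asym 1+x<0 (+-pos-nonneg 0<1 (inj₁ 0<x)))
      where
      0<x : 0# < x
      0<x = subst (0# <_) ([1+x]*ratio≡x root-1+x≢0) (*-neg-neg 1+x<0 ratio-root-neg)
    ... | tri≈ _ 1+x≡0 _ = ⊥-elim (root-1+x≢0 1+x≡0)
    ... | tri> _ _ 0<1+x = -1<x , subst (_< 0#) ([1+x]*ratio≡x root-1+x≢0) (*-pos-neg 0<1+x ratio-root-neg)
      where
      -1<x : - 1# < x
      -1<x = subst₂ _<_ (+-identityʳ (- 1#)) (solve 1 (λ x → :- :1 :+ (:1 :+ x) := x) refl x) (+-monoˡ-< (- 1#) 0<1+x)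

  S-even-no-root : ∀ k x → ¬ (S (k ℕ.* 2) x ≡ 0#)
  S-even-no-root k x Sx≡0 =
    <⇒≢ (logSum-odd-neg k (ratio-root-neg (k ℕ.* 2) Sx≡0)) (logSum-at-ratio-root (k ℕ.* 2) Sx≡0)

  module _ k {x} (Sx≡0 : S (suc (k ℕ.* 2)) x ≡ 0#) where

    ratio-odd-root<-1 : ratio x < - 1#
    ratio-odd-root<-1 with ≤-<-cases (- 1#) (ratio x)
    ... | inj₁ -1≤r = ⊥-elim (<⇒≢ (logSum-even-neg -1≤r (ratio-root-neg (suc (k ℕ.* 2)) Sx≡0) k)
                                  (logSum-at-ratio-root (suc (k ℕ.* 2)) Sx≡0))
    ... | inj₂ r<-1 = r<-1

  S-odd-root-unique : ∀ k {x y} → S (suc (k ℕ.* 2)) x ≡ 0# → S (suc (k ℕ.* 2)) y ≡ 0# → x ≡ y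
  S-odd-root-unique k {x} {y} Sx≡0 Sy≡0 = ratio-injective (root-1+x≢0 d Sx≡0) (root-1+x≢0 d Sy≡0)
    (logSum-even-injective k (inj₁ (ratio-odd-root<-1 k Sx≡0)) (inj₁ (ratio-odd-root<-1 k Sy≡0))
      (trans (logSum-at-ratio-root d Sx≡0) (sym (logSum-at-ratio-root d Sy≡0))))
    where
    d : ℕ
    d = suc (k ℕ.* 2)

  S-odd-has-root : ∀ k → Σ Carrier λ x → S (suc (k ℕ.* 2)) x ≡ 0#
  S-odd-has-root k = map₂ proj₂ (intermediate-value (S d) (inj₁ -1<0) (lipschitzConstant-nonneg (C (suc (suc d))))
    (λ -1≤y y≤0 -1≤z z≤0 → S-lipschitz d (∣y∣≤1 -1≤y y≤0) (∣y∣≤1 -1≤z z≤0)) S[-1]<0 0<S[0])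
    where
    d : ℕ
    d = suc (k ℕ.* 2)
    -1<0 : - 1# < 0#
    -1<0 = 0<x⇒-x<0 0<1
    ∣y∣≤1 : ∀ {y} → - 1# ≤ y → y ≤ 0# → ∣ y ∣ ≤ 1#
    ∣y∣≤1 -1≤y y≤0 = ∣x∣≤c (≤-trans y≤0 (inj₁ 0<1)) (subst (_ ≤_) (-‿involutive 1#) (neg-antimono-≤ -1≤y))
    S[-1]<0 : S d (- 1#) < 0#
    S[-1]<0 = subst (_< 0#) (sym (S-at-−1 d)) (*-neg-pos (^-odd-neg k -1<0) (1/[1+n]-pos d))
    0<S[0] : 0# < S d 0#
    0<S[0] = subst (0# <_) (sym (S-at-0 d)) 0<1

proposition6p4 : (R : RealField) → let open RealField R in
    ((n : ℕ) → 2 N.≤ n → n % 2 ≡ 0 → (x : Carrier) → ¬ (eval (C n) x ≡ 0#))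
    × ((n : ℕ) → 3 N.≤ n → n % 2 ≡ 1 →
        Σ Carrier λ r → eval (C n) r ≡ 0# × (- 1# < r × r < 0#)
                        × ((y : Carrier) → eval (C n) y ≡ 0# → y ≡ r))
proposition6p4 R = no-root , unique-root
  where
  open OrderedFieldProperties R
  open PolynomialC R using (S; eval-C≡S)
  open RootsOfS R
  open import Data.Product using (_,_; proj₁; proj₂)
  open import Relation.Binary.PropositionalEquality using (refl; trans; sym)

  no-root : (n : ℕ) → 2 N.≤ n → n % 2 ≡ 0 → (x : Carrier) → ¬ (eval (C n) x ≡ 0#)
  no-root n 2≤n n%2≡0 x with Parity.even-≥2 n 2≤n n%2≡0
  ... | k , refl = λ root → S-even-no-root k x (trans (sym (eval-C≡S (k N.* 2) x)) root)

  unique-root : (n : ℕ) → 3 N.≤ n → n % 2 ≡ 1 →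
                Σ Carrier λ r → eval (C n) r ≡ 0# × (- 1# < r × r < 0#) × ((y : Carrier) → eval (C n) y ≡ 0# → y ≡ r)
  unique-root n 3≤n n%2≡1 with Parity.odd-≥3 n 3≤n n%2≡1
  ... | k , refl = r , trans (eval-C≡S d r) Sr≡0 , root-location d Sr≡0 ,
                   λ y root → S-odd-root-unique k (trans (sym (eval-C≡S d y)) root) Sr≡0
    where
    d : ℕ
    d = N.suc (k N.* 2)
    r : Carrier
    r = proj₁ (S-odd-has-root k)
    Sr≡0 : S d r ≡ 0#
    Sr≡0 = proj₂ (S-odd-has-root k)
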